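{- Let $A\geq a\geq 1$ and $r\geq 1$ be integers. Then, as formal power series in $q$ (equivalently for $|q|<1$) with $z$ a formal variable, \[ \sum_{\pi\in\overline{\mathcal{P}}}z^{mes_{r,A,a}(\pi)}q^{|\pi|} =\frac{(-q;q)_{\infty}}{(q;q)_{\infty}}\sum_{k=0}^{\infty}z^{kA+a}\bigg[\frac{2^kq^{r[A\binom{k}{2}+ka]}}{(-q^a;q^A)_k}-\frac{2^{k+1}q^{r[A\binom{k+1}{2}+(k+1)a]}}{(-q^a;q^A)_{k+1}}\bigg]. \]
   Context: An overpartition is a partition (finite non-increasing sequence of positive integers) in which the first occurrence of each part value may be overlined; $\overline{\mathcal{P}}$ denotes the set of all overpartitions (including the empty one) and $|\pi|$ the sum of the parts of $\pi$. A part $\pi_i$ is of size $t$ if $\pi_i=t$ or $\pi_i=\overline{t}$. $(a;q)_\infty=\prod_{i\geq0}(1-aq^i)$ and $(a;q)_n=(a;q)_\infty/(aq^n;q)_\infty$, so $(a;q)_0=1$. For $r\geq1$, $mes_{r,A,a}(\pi)$ is the smallest positive integer $\equiv a\pmod A$ such that there are fewer than $r$ parts of size $mes_{r,A,a}(\pi)$ in $\pi$ (counting overlined and non-overlined parts). -}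

module Defs where

open import Data.Nat as ℕ using (ℕ; zero; suc; _≤_; _<_; _∸_; _≟_)
open import Data.Nat.Combinatorics using (_C_)
open import Data.Integer as ℤ using (ℤ; +_)
open import Data.Integer.Divisibility as ℤd using ()
open import Data.Bool using (Bool; true; false; if_then_else_)
open import Data.List using (List; []; _∷_; length; filter; map)
open import Data.Nat.ListAction using (sum)
open import Data.List.Relation.Unary.All using (All)
open import Data.List.Relation.Unary.Linked using (Linked)
open import Data.List.Relation.Unary.Unique.Propositional using (Unique)
open import Data.List.Membership.Propositional using (_∈_)
open import Data.Product using (_×_; _,_; proj₁; proj₂)
open import Function.Bundles using (_⇔_)
open import Relation.Nullary.Decidable using (⌊_⌋)
open import Relation.Binary.PropositionalEquality using (_≡_)

-- A part is (size , overlined?)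
Part : Set
Part = ℕ × Bool

size : Part → ℕ
size = proj₁

-- consecutive parts: non-increasing sizes; only the first (leftmost)
-- occurrence of a size may be overlined
ValidAdj : Part → Part → Set
ValidAdj (v₁ , b₁) (v₂ , b₂) = (v₂ ≤ v₁) × (v₁ ≡ v₂ → b₂ ≡ false)

IsOverpartition : List Part → Set
IsOverpartition π = All (λ p → 1 ≤ size p) π × Linked ValidAdj π

weight : List Part → ℕ
weight π = sum (map size π)

countSize : ℕ → List Part → ℕ
countSize t π = length (filter (λ p → size p ≟ t) π)

_≡_[mod_] : ℕ → ℕ → ℕ → Set
m ≡ a [mod A ] = (+ A) ℤd.∣ ((+ m) ℤ.- (+ a))

IsMes : ℕ → ℕ → ℕ → List Part → ℕ → Set
IsMes r A a π m =
  (1 ≤ m) × (m ≡ a [mod A ]) × (countSize m π < r) ×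
  (∀ j → 1 ≤ j → j < m → j ≡ a [mod A ] → r ≤ countSize j π)

HasCard : (List Part → Set) → ℤ → Set
HasCard P c = Data.Product.Σ (List (List Part)) λ L →
  Unique L × (∀ π → (π ∈ L) ⇔ P π) × ((+ length L) ≡ c)

Series : Set
Series = ℕ → ℤ

sumBelow : (ℕ → ℤ) → ℕ → ℤ
sumBelow f zero = ℤ.0ℤ
sumBelow f (suc n) = sumBelow f n ℤ.+ f n

sZero : Series
sZero _ = ℤ.0ℤ

sOne : Series
sOne n = if ⌊ n ≟ 0 ⌋ then ℤ.1ℤ else ℤ.0ℤ

mono : ℤ → ℕ → Series
mono c e n = if ⌊ n ≟ e ⌋ then c else ℤ.0ℤ

_⊕_ : Series → Series → Series
(f ⊕ g) n = f n ℤ.+ g n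

_⊖_ : Series → Series → Series
(f ⊖ g) n = f n ℤ.- g n

_⊛_ : Series → Series → Series
(f ⊛ g) n = sumBelow (λ i → f i ℤ.* g (n ∸ i)) (suc n)

infixl 6 _⊕_ _⊖_
infixl 7 _⊛_

-- Inverse of a series with constant term 1:
-- g 0 = 1, g N = - Σ_{i=1}^{N} f i * g (N - i).
-- invApprox f n has correct coefficients in degrees ≤ n.
invApprox : Series → ℕ → Series
invApprox f zero j = if ⌊ j ≟ 0 ⌋ then ℤ.1ℤ else ℤ.0ℤ
invApprox f (suc n) j =
  if ⌊ j ≟ suc n ⌋
  then ℤ.- sumBelow (λ i → f (suc i) ℤ.* invApprox f n (n ∸ i)) (suc n)
  else invApprox f n j

inv : Series → Series
inv f n = invApprox f n n

-- finite q-Pochhammer  Π_{i<k} (1 - c q^{e + d i})   (so (x q^e ; q^d)_k with x = c)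
pochFin : ℤ → ℕ → ℕ → ℕ → Series
pochFin c e d zero = sOne
pochFin c e d (suc k) = pochFin c e d k ⊛ (sOne ⊖ mono c (e ℕ.+ d ℕ.* k))

-- infinite q-Pochhammer Π_{i≥0} (1 - c q^{e + d i}) for e ≥ 1, d ≥ 1:
-- its q^n coefficient is that of the product of the factors with
-- exponent ≤ n, i.e. (for e,d ≥ 1) of the first n+1 factors.
pochInf : ℤ → ℕ → ℕ → Series
pochInf c e d n = pochFin c e d (suc n) n

overPartGF : Series
overPartGF = pochInf (ℤ.- ℤ.1ℤ) 1 1 ⊛ inv (pochInf ℤ.1ℤ 1 1)

termT : ℕ → ℕ → ℕ → ℕ → Series
termT r A a k =
  mono (+ (2 ℕ.^ k)) (r ℕ.* (A ℕ.* (k C 2) ℕ.+ k ℕ.* a)) ⊛ inv (pochFin (ℤ.- ℤ.1ℤ) a A k)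

bracket : ℕ → ℕ → ℕ → ℕ → Series
bracket r A a k = termT r A a k ⊖ termT r A a (suc k)

-- coefficient of z^m in Σ_{k≥0} z^{kA+a} [ ... ]: sum over the (finitely many,
-- as A ≥ 1 forces k ≤ m) k with kA + a = m.
zCoeffSum : ℕ → ℕ → ℕ → ℕ → Series
zCoeffSum r A a m n =
  sumBelow (λ k → if ⌊ k ℕ.* A ℕ.+ a ≟ m ⌋ then bracket r A a k n else ℤ.0ℤ) (suc m)

rhsCoeff : ℕ → ℕ → ℕ → ℕ → ℕ → ℤ
rhsCoeff r A a m n = (overPartGF ⊛ zCoeffSum r A a m) n

-- Give every part size t a constraint on its multiplicity: none, at least r, or fewer than r.
-- The overpartitions obeying such a profile have as generating function the product over t of
-- (1 + q^t)/(1 - q^t), 2q^{rt}/(1 - q^t), or the difference of the two. Demanding at least r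
-- parts of each size a, a + A, …, (k - 1)A + a multiplies (-q;q)_∞/(q;q)_∞ by
-- 2^k q^{r[A C(k,2) + ka]}/(-q^a;q^A)_k, one factor 1 + q^t being traded for 2q^{rt} per size;
-- and mes = kA + a says that this holds for k while size kA + a occurs fewer than r times,
-- so its generating function is the difference of the terms for k and k + 1. Only sizes up
-- to n affect the coefficient of q^n, so the series are compared up to a degree, and the
-- overpartitions themselves are listed size by size, which realises each coefficient as a count.

module Submission where

open import Defs

open import Algebra.Bundles using (CommutativeMonoid)
open import Algebra.Structures using (IsCommutativeMonoid)
import Algebra.Properties.CommutativeSemigroup as CommutativeSemigroupProperties
import Algebra.Properties.Monoid as MonoidProperties
open import Data.Bool using (Bool; true; false; if_then_else_; _∧_)
open import Data.Empty using (⊥-elim)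
open import Data.Integer as ℤ using (ℤ; +_; 0ℤ; 1ℤ)
import Data.Integer.Properties as ℤP
open import Data.Integer.Tactic.RingSolver using (solve-∀)
open import Data.List using (List; []; _∷_; length; replicate; _++_; map; filter; cartesianProductWith)
import Data.List.Properties as LP
open import Data.List.Membership.Propositional using (_∈_)
import Data.List.Membership.Propositional.Properties as Mem
open import Data.List.Relation.Binary.Disjoint.Propositional using (Disjoint)
open import Data.List.Relation.Unary.All as All using (All; []; _∷_)
import Data.List.Relation.Unary.All.Properties as AllP
open import Data.List.Relation.Unary.AllPairs using ([]; _∷_)
open import Data.List.Relation.Unary.Any using (here; there)
open import Data.List.Relation.Unary.Linked as Lk using (Linked; []; [-]; _∷_)
open import Data.List.Relation.Unary.Unique.Propositional using (Unique)
import Data.List.Relation.Unary.Unique.Propositional.Properties as UP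
open import Data.Nat as ℕ using (ℕ; zero; suc; _≤_; _<_; _∸_; z≤n; s≤s; _/_)
open import Data.Nat.Combinatorics using (_C_)
import Data.Nat.Combinatorics as NC
open import Data.Nat.Divisibility as ND using (_∣_; _∣?_)
import Data.Nat.DivMod as DM
open import Data.Nat.ListAction using (sum)
import Data.Nat.ListAction.Properties as ListActionP
import Data.Nat.Properties as ℕP
import Data.Nat.Tactic.RingSolver as ℕSolver
open import Data.Product using (_×_; _,_; proj₁; proj₂; ∃)
open import Data.Sum using (inj₁; inj₂)
open import Data.Unit using (⊤; tt)
open import Function using (_∘_; id)
open import Function.Bundles using (_⇔_; mk⇔)
open import Function.Construct.Composition using (_⇔-∘_)
open import Level using (0ℓ)
open import Relation.Binary.Bundles using (Setoid)
open import Relation.Binary.PropositionalEquality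
import Relation.Binary.Reasoning.Setoid as SetoidReasoning
open import Relation.Nullary using (¬_; Dec; yes; no; _×-dec_)
open import Relation.Nullary.Decidable using (⌊_⌋; isYes≗does; dec-true; dec-false)

sumBelow-cong : ∀ {f g : ℕ → ℤ} n → (∀ i → i < n → f i ≡ g i) → sumBelow f n ≡ sumBelow g n
sumBelow-cong zero eq = refl
sumBelow-cong (suc n) eq =
  cong₂ ℤ._+_ (sumBelow-cong n (λ i i<n → eq i (ℕP.m<n⇒m<1+n i<n))) (eq n ℕP.≤-refl)

sumBelow-+ : ∀ (f g : ℕ → ℤ) n → sumBelow (λ i → f i ℤ.+ g i) n ≡ sumBelow f n ℤ.+ sumBelow g n
sumBelow-+ f g zero = refl
sumBelow-+ f g (suc n) rewrite sumBelow-+ f g n = swap (sumBelow f n) (sumBelow g n) (f n) (g n)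
  where
  swap : ∀ (a b c d : ℤ) → a ℤ.+ b ℤ.+ (c ℤ.+ d) ≡ a ℤ.+ c ℤ.+ (b ℤ.+ d)
  swap = solve-∀

sumBelow-neg : ∀ (f : ℕ → ℤ) n → sumBelow (λ i → ℤ.- f i) n ≡ ℤ.- sumBelow f n
sumBelow-neg f zero = refl
sumBelow-neg f (suc n) rewrite sumBelow-neg f n = sym (ℤP.neg-distrib-+ (sumBelow f n) (f n))

sumBelow-*ˡ : ∀ (c : ℤ) (f : ℕ → ℤ) n → sumBelow (λ i → c ℤ.* f i) n ≡ c ℤ.* sumBelow f n
sumBelow-*ˡ c f zero = sym (ℤP.*-zeroʳ c)
sumBelow-*ˡ c f (suc n) rewrite sumBelow-*ˡ c f n = sym (ℤP.*-distribˡ-+ c (sumBelow f n) (f n))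

sumBelow-*ʳ : ∀ (c : ℤ) (f : ℕ → ℤ) n → sumBelow (λ i → f i ℤ.* c) n ≡ sumBelow f n ℤ.* c
sumBelow-*ʳ c f n =
  trans (sumBelow-cong n (λ i _ → ℤP.*-comm (f i) c)) (trans (sumBelow-*ˡ c f n) (ℤP.*-comm c _))

sumBelow-zero : ∀ (f : ℕ → ℤ) n → (∀ i → i < n → f i ≡ 0ℤ) → sumBelow f n ≡ 0ℤ
sumBelow-zero f zero _ = refl
sumBelow-zero f (suc n) f≡0
  rewrite sumBelow-zero f n (λ i i<n → f≡0 i (ℕP.m<n⇒m<1+n i<n)) | f≡0 n ℕP.≤-refl = refl

sumBelow-unfoldˡ : ∀ (f : ℕ → ℤ) n → sumBelow f (suc n) ≡ f 0 ℤ.+ sumBelow (λ i → f (suc i)) n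
sumBelow-unfoldˡ f zero = trans (ℤP.+-identityˡ (f 0)) (sym (ℤP.+-identityʳ (f 0)))
sumBelow-unfoldˡ f (suc n) rewrite sumBelow-unfoldˡ f n = ℤP.+-assoc (f 0) _ _

sumBelow-single : ∀ (f : ℕ → ℤ) n j → j < n → (∀ i → i < n → i ≢ j → f i ≡ 0ℤ) →
                  sumBelow f n ≡ f j
sumBelow-single f (suc n) j j<1+n others with j ℕ.≟ n
... | yes refl
  rewrite sumBelow-zero f j (λ i i<j → others i (ℕP.m<n⇒m<1+n i<j) (ℕP.<⇒≢ i<j))
  = ℤP.+-identityˡ (f j)
... | no j≢n
  rewrite sumBelow-single f n j (ℕP.≤∧≢⇒< (ℕP.≤-pred j<1+n) j≢n)
                          (λ i i<n → others i (ℕP.m<n⇒m<1+n i<n))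
        | others n ℕP.≤-refl (j≢n ∘ sym)
  = ℤP.+-identityʳ (f j)

sumBelow-reverse : ∀ (f : ℕ → ℤ) n → sumBelow f n ≡ sumBelow (λ i → f (n ∸ suc i)) n
sumBelow-reverse f zero = refl
sumBelow-reverse f (suc n) = trans (cong (ℤ._+ f n) (sumBelow-reverse f n))
  (trans (ℤP.+-comm _ (f n)) (sym (sumBelow-unfoldˡ (λ i → f (suc n ∸ suc i)) n)))

sumBelow-triangle : ∀ (F : ℕ → ℕ → ℤ) n →
  sumBelow (λ i → sumBelow (F i) (suc (n ∸ i))) (suc n) ≡
  sumBelow (λ s → sumBelow (λ i → F i (s ∸ i)) (suc s)) (suc n)
sumBelow-triangle F zero = refl
sumBelow-triangle F (suc n) = begin
    sumBelow (λ i → sumBelow (F i) (suc (suc n ∸ i))) (suc n) ℤ.+ sumBelow (F (suc n)) (suc (n ∸ n))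
  ≡⟨ cong₂ ℤ._+_ (sumBelow-cong (suc n) row) (cong (λ k → sumBelow (F (suc n)) (suc k)) (ℕP.n∸n≡0 n)) ⟩
    sumBelow (λ i → sumBelow (F i) (suc (n ∸ i)) ℤ.+ F i (suc n ∸ i)) (suc n) ℤ.+ (0ℤ ℤ.+ F (suc n) 0)
  ≡⟨ cong₂ ℤ._+_ (sumBelow-+ _ _ (suc n)) (ℤP.+-identityˡ _) ⟩
    sumBelow (λ i → sumBelow (F i) (suc (n ∸ i))) (suc n) ℤ.+ diagonal ℤ.+ F (suc n) 0
  ≡⟨ cong (λ x → x ℤ.+ diagonal ℤ.+ F (suc n) 0) (sumBelow-triangle F n) ⟩
    antidiagonals (suc n) ℤ.+ diagonal ℤ.+ F (suc n) 0
  ≡⟨ ℤP.+-assoc (antidiagonals (suc n)) diagonal (F (suc n) 0) ⟩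
    antidiagonals (suc n) ℤ.+ (diagonal ℤ.+ F (suc n) 0)
  ≡⟨ cong (λ k → antidiagonals (suc n) ℤ.+ (diagonal ℤ.+ F (suc n) k)) (ℕP.n∸n≡0 n) ⟨
    antidiagonals (suc (suc n))
  ∎
  where
  open ≡-Reasoning
  antidiagonals : ℕ → ℤ
  antidiagonals = sumBelow (λ s → sumBelow (λ i → F i (s ∸ i)) (suc s))
  diagonal : ℤ
  diagonal = sumBelow (λ i → F i (suc n ∸ i)) (suc n)
  row : ∀ i → i < suc n → sumBelow (F i) (suc (suc n ∸ i)) ≡ sumBelow (F i) (suc (n ∸ i)) ℤ.+ F i (suc n ∸ i)
  row i (s≤s i≤n) rewrite ℕP.+-∸-assoc 1 i≤n = refl

module ≗-Reasoning = SetoidReasoning (ℕ →-setoid ℤ)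

⊕-cong : ∀ {f f′ g g′} → f ≗ f′ → g ≗ g′ → f ⊕ g ≗ f′ ⊕ g′
⊕-cong f≗f′ g≗g′ n = cong₂ ℤ._+_ (f≗f′ n) (g≗g′ n)

⊖-cong : ∀ {f f′ g g′} → f ≗ f′ → g ≗ g′ → f ⊖ g ≗ f′ ⊖ g′
⊖-cong f≗f′ g≗g′ n = cong₂ ℤ._-_ (f≗f′ n) (g≗g′ n)

⊛-cong : ∀ {f f′ g g′} → f ≗ f′ → g ≗ g′ → f ⊛ g ≗ f′ ⊛ g′
⊛-cong f≗f′ g≗g′ n = sumBelow-cong (suc n) (λ i _ → cong₂ ℤ._*_ (f≗f′ i) (g≗g′ (n ∸ i)))

⊛-congˡ : ∀ h {f g} → f ≗ g → h ⊛ f ≗ h ⊛ g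
⊛-congˡ h = ⊛-cong {h} {h} (λ _ → refl)

⊛-congʳ : ∀ h {f g} → f ≗ g → f ⊛ h ≗ g ⊛ h
⊛-congʳ h f≗g = ⊛-cong {g = h} {g′ = h} f≗g (λ _ → refl)

⊛-comm : ∀ f g → f ⊛ g ≗ g ⊛ f
⊛-comm f g n = trans (sumBelow-reverse (λ i → f i ℤ.* g (n ∸ i)) (suc n))
  (sumBelow-cong (suc n) λ { i (s≤s i≤n) →
    trans (ℤP.*-comm (f (n ∸ i)) (g (n ∸ (n ∸ i)))) (cong (λ j → g j ℤ.* f (n ∸ i)) (ℕP.m∸[m∸n]≡n i≤n)) })

⊛-assoc : ∀ f g h → (f ⊛ g) ⊛ h ≗ f ⊛ (g ⊛ h)
⊛-assoc f g h n = sym (begin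
    sumBelow (λ i → f i ℤ.* sumBelow (λ j → g j ℤ.* h (n ∸ i ∸ j)) (suc (n ∸ i))) (suc n)
  ≡⟨ sumBelow-cong (suc n) (λ i _ → sumBelow-*ˡ (f i) _ (suc (n ∸ i))) ⟨
    sumBelow (λ i → sumBelow (F i) (suc (n ∸ i))) (suc n)
  ≡⟨ sumBelow-triangle F n ⟩
    sumBelow (λ s → sumBelow (λ i → F i (s ∸ i)) (suc s)) (suc n)
  ≡⟨ sumBelow-cong (suc n) (λ s s≤n → trans (sumBelow-cong (suc s) (λ i i≤s → regroup s i s≤n i≤s))
                                            (sumBelow-*ʳ (h (n ∸ s)) _ (suc s))) ⟩
    sumBelow (λ s → sumBelow (λ i → f i ℤ.* g (s ∸ i)) (suc s) ℤ.* h (n ∸ s)) (suc n)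
  ∎)
  where
  open ≡-Reasoning
  F : ℕ → ℕ → ℤ
  F i j = f i ℤ.* (g j ℤ.* h (n ∸ i ∸ j))
  regroup : ∀ s i → s < suc n → i < suc s → F i (s ∸ i) ≡ f i ℤ.* g (s ∸ i) ℤ.* h (n ∸ s)
  regroup s i (s≤s s≤n) (s≤s i≤s) =
    trans (cong (λ k → f i ℤ.* (g (s ∸ i) ℤ.* h k))
                (trans (ℕP.∸-+-assoc n i (s ∸ i)) (cong (n ∸_) (ℕP.m+[n∸m]≡n i≤s))))
          (sym (ℤP.*-assoc (f i) _ _))

⊕⇒⊖ : ∀ f g {h} → f ⊕ g ≗ h → f ≗ h ⊖ g
⊕⇒⊖ f g {h} f⊕g≗h n = begin
  f n                      ≡⟨ ℤP.+-identityʳ (f n) ⟨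
  f n ℤ.+ 0ℤ               ≡⟨ cong (λ x → f n ℤ.+ x) (ℤP.+-inverseʳ (g n)) ⟨
  f n ℤ.+ (g n ℤ.- g n)    ≡⟨ ℤP.+-assoc (f n) (g n) (ℤ.- g n) ⟨
  f n ℤ.+ g n ℤ.- g n      ≡⟨ cong (ℤ._- g n) (f⊕g≗h n) ⟩
  h n ℤ.- g n              ∎
  where open ≡-Reasoning

⊛-zeroʳ : ∀ f → f ⊛ sZero ≗ sZero
⊛-zeroʳ f n = sumBelow-zero _ (suc n) (λ i _ → ℤP.*-zeroʳ (f i))

⊛-distribˡ-⊕ : ∀ f g h → f ⊛ (g ⊕ h) ≗ f ⊛ g ⊕ f ⊛ h
⊛-distribˡ-⊕ f g h n =
  trans (sumBelow-cong (suc n) (λ i _ → ℤP.*-distribˡ-+ (f i) _ _)) (sumBelow-+ _ _ (suc n))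

⊛-distribʳ-⊕ : ∀ f g h → (g ⊕ h) ⊛ f ≗ g ⊛ f ⊕ h ⊛ f
⊛-distribʳ-⊕ f g h n = begin
  ((g ⊕ h) ⊛ f) n    ≡⟨ ⊛-comm (g ⊕ h) f n ⟩
  (f ⊛ (g ⊕ h)) n    ≡⟨ ⊛-distribˡ-⊕ f g h n ⟩
  (f ⊛ g ⊕ f ⊛ h) n  ≡⟨ ⊕-cong (⊛-comm f g) (⊛-comm f h) n ⟩
  (g ⊛ f ⊕ h ⊛ f) n  ∎
  where open ≡-Reasoning

⊛-distribˡ-⊖ : ∀ f g h → f ⊛ (g ⊖ h) ≗ f ⊛ g ⊖ f ⊛ h
⊛-distribˡ-⊖ f g h n = trans (sumBelow-cong (suc n) (λ i _ → distrib (f i) _ _))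
  (trans (sumBelow-+ _ _ (suc n)) (cong (λ x → (f ⊛ g) n ℤ.+ x) (sumBelow-neg _ (suc n))))
  where
  distrib : ∀ (a b c : ℤ) → a ℤ.* (b ℤ.- c) ≡ a ℤ.* b ℤ.+ ℤ.- (a ℤ.* c)
  distrib = solve-∀

mono-at : ∀ c e → mono c e e ≡ c
mono-at c e with e ℕ.≟ e
... | yes _ = refl
... | no e≢e = ⊥-elim (e≢e refl)

mono-off : ∀ c e n → n ≢ e → mono c e n ≡ 0ℤ
mono-off c e n n≢e with n ℕ.≟ e
... | yes n≡e = ⊥-elim (n≢e n≡e)
... | no _ = refl

mono-cong : ∀ {c c′ e e′} → c ≡ c′ → e ≡ e′ → mono c e ≗ mono c′ e′
mono-cong refl refl _ = refl

mono⊛-≥ : ∀ c e f n → e ≤ n → (mono c e ⊛ f) n ≡ c ℤ.* f (n ∸ e)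
mono⊛-≥ c e f n e≤n =
  trans (sumBelow-single _ (suc n) e (s≤s e≤n)
           (λ i _ i≢e → trans (cong (ℤ._* f (n ∸ i)) (mono-off c e i i≢e)) (ℤP.*-zeroˡ (f (n ∸ i)))))
        (cong (ℤ._* f (n ∸ e)) (mono-at c e))

mono⊛-< : ∀ c e f n → n < e → (mono c e ⊛ f) n ≡ 0ℤ
mono⊛-< c e f n n<e = sumBelow-zero _ (suc n) λ { i (s≤s i≤n) →
  trans (cong (ℤ._* f (n ∸ i)) (mono-off c e i (ℕP.<⇒≢ (ℕP.≤-<-trans i≤n n<e)))) (ℤP.*-zeroˡ (f (n ∸ i))) }

⊛-identityˡ : ∀ f → sOne ⊛ f ≗ f
⊛-identityˡ f n = trans (mono⊛-≥ 1ℤ 0 f n z≤n) (ℤP.*-identityˡ (f n))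

⊛-identityʳ : ∀ f → f ⊛ sOne ≗ f
⊛-identityʳ f n = trans (⊛-comm f sOne n) (⊛-identityˡ f n)

mono⊛mono : ∀ c d e e′ → mono c e ⊛ mono d e′ ≗ mono (c ℤ.* d) (e ℕ.+ e′)
mono⊛mono c d e e′ n with e ℕ.≤? n
... | no e≰n = trans (mono⊛-< c e (mono d e′) n (ℕP.≰⇒> e≰n))
  (sym (mono-off _ _ n λ n≡e+e′ → e≰n (subst (e ≤_) (sym n≡e+e′) (ℕP.m≤m+n e e′))))
... | yes e≤n with n ∸ e ℕ.≟ e′
...   | yes refl = trans (mono⊛-≥ c e (mono d e′) n e≤n)
  (trans (cong (c ℤ.*_) (mono-at d (n ∸ e)))
         (sym (trans (cong (mono (c ℤ.* d) _) (sym (ℕP.m+[n∸m]≡n e≤n))) (mono-at _ _))))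
...   | no n∸e≢e′ = trans (mono⊛-≥ c e (mono d e′) n e≤n)
  (trans (cong (c ℤ.*_) (mono-off d e′ _ n∸e≢e′))
  (trans (ℤP.*-zeroʳ c) (sym (mono-off _ _ n λ n≡e+e′ → n∸e≢e′ (trans (cong (_∸ e) n≡e+e′) (ℕP.m+n∸m≡n e e′))))))

⊛-isCommutativeMonoid : IsCommutativeMonoid _≗_ _⊛_ sOne
⊛-isCommutativeMonoid = record
  { isMonoid = record
    { isSemigroup = record
      { isMagma = record
        { isEquivalence = Setoid.isEquivalence (ℕ →-setoid ℤ)
        ; ∙-cong = ⊛-cong
        }
      ; assoc = ⊛-assoc
      }
    ; identity = ⊛-identityˡ , ⊛-identityʳ
    }
  ; comm = ⊛-comm
  }

⊛-commutativeMonoid : CommutativeMonoid 0ℓ 0ℓ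
⊛-commutativeMonoid = record { isCommutativeMonoid = ⊛-isCommutativeMonoid }

open CommutativeSemigroupProperties (CommutativeMonoid.commutativeSemigroup ⊛-commutativeMonoid)
  using (interchange; xy∙z≈xz∙y)
open MonoidProperties (CommutativeMonoid.monoid ⊛-commutativeMonoid)
  using (cancelʳ; insertʳ)

⊛-constant : ∀ f g → (f ⊛ g) 0 ≡ f 0 ℤ.* g 0
⊛-constant f g = ℤP.+-identityˡ _

invApprox-suc-below : ∀ f n j → j ≢ suc n → invApprox f (suc n) j ≡ invApprox f n j
invApprox-suc-below f n j j≢1+n with j ℕ.≟ suc n
... | yes j≡1+n = ⊥-elim (j≢1+n j≡1+n)
... | no _ = refl

invApprox-suc-top : ∀ f n →
  invApprox f (suc n) (suc n) ≡ ℤ.- sumBelow (λ i → f (suc i) ℤ.* invApprox f n (n ∸ i)) (suc n)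
invApprox-suc-top f n with suc n ℕ.≟ suc n
... | yes _ = refl
... | no 1+n≢1+n = ⊥-elim (1+n≢1+n refl)

invApprox-stable : ∀ f n j → j ≤ n → invApprox f n j ≡ inv f j
invApprox-stable f zero zero z≤n = refl
invApprox-stable f (suc n) j j≤1+n with ℕP.m≤n⇒m<n∨m≡n j≤1+n
... | inj₂ refl = refl
... | inj₁ j<1+n = trans (invApprox-suc-below f n j (ℕP.<⇒≢ j<1+n)) (invApprox-stable f n j (ℕP.≤-pred j<1+n))

⊛-inverseʳ : ∀ f → f 0 ≡ 1ℤ → f ⊛ inv f ≗ sOne
⊛-inverseʳ f f0≡1 zero = trans (⊛-constant f (inv f)) (cong (ℤ._* 1ℤ) f0≡1)
⊛-inverseʳ f f0≡1 (suc N) = begin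
    (f ⊛ inv f) (suc N)
  ≡⟨ sumBelow-unfoldˡ _ (suc N) ⟩
    f 0 ℤ.* inv f (suc N) ℤ.+ sumBelow (λ i → f (suc i) ℤ.* inv f (N ∸ i)) (suc N)
  ≡⟨ cong₂ (λ c s → c ℤ.* inv f (suc N) ℤ.+ s) f0≡1
       (sumBelow-cong (suc N) (λ i _ → cong (f (suc i) ℤ.*_) (sym (invApprox-stable f N (N ∸ i) (ℕP.m∸n≤m N i))))) ⟩
    1ℤ ℤ.* inv f (suc N) ℤ.+ S
  ≡⟨ cong (λ x → 1ℤ ℤ.* x ℤ.+ S) (invApprox-suc-top f N) ⟩
    1ℤ ℤ.* (ℤ.- S) ℤ.+ S
  ≡⟨ cancel S ⟩
    0ℤ
  ∎
  where
  open ≡-Reasoning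
  S : ℤ
  S = sumBelow (λ i → f (suc i) ℤ.* invApprox f N (N ∸ i)) (suc N)
  cancel : ∀ (x : ℤ) → 1ℤ ℤ.* (ℤ.- x) ℤ.+ x ≡ 0ℤ
  cancel = solve-∀

⊛-inverseˡ : ∀ f → f 0 ≡ 1ℤ → inv f ⊛ f ≗ sOne
⊛-inverseˡ f f0≡1 n = trans (⊛-comm (inv f) f n) (⊛-inverseʳ f f0≡1 n)

inv-unique : ∀ f h → f 0 ≡ 1ℤ → f ⊛ h ≗ sOne → h ≗ inv f
inv-unique f h f0≡1 fh≗1 = begin
  h                  ≈⟨ insertʳ {a = f} {c = inv f} (⊛-inverseʳ f f0≡1) h ⟩
  (h ⊛ f) ⊛ inv f    ≈⟨ ⊛-congʳ (inv f) (λ n → trans (⊛-comm h f n) (fh≗1 n)) ⟩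
  sOne ⊛ inv f       ≈⟨ ⊛-identityˡ (inv f) ⟩
  inv f              ∎
  where open ≗-Reasoning

inv-distrib-⊛ : ∀ f g → f 0 ≡ 1ℤ → g 0 ≡ 1ℤ → inv (f ⊛ g) ≗ inv f ⊛ inv g
inv-distrib-⊛ f g f0≡1 g0≡1 n = sym (inv-unique (f ⊛ g) (inv f ⊛ inv g) fg0≡1 product≗1 n)
  where
  open ≗-Reasoning
  fg0≡1 : (f ⊛ g) 0 ≡ 1ℤ
  fg0≡1 = trans (⊛-constant f g) (cong₂ ℤ._*_ f0≡1 g0≡1)
  product≗1 : (f ⊛ g) ⊛ (inv f ⊛ inv g) ≗ sOne
  product≗1 = begin
    (f ⊛ g) ⊛ (inv f ⊛ inv g)  ≈⟨ interchange f g (inv f) (inv g) ⟩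
    (f ⊛ inv f) ⊛ (g ⊛ inv g)  ≈⟨ ⊛-cong (⊛-inverseʳ f f0≡1) (⊛-inverseʳ g g0≡1) ⟩
    sOne ⊛ sOne                ≈⟨ ⊛-identityˡ sOne ⟩
    sOne                       ∎

infix 4 _≈[_]_
_≈[_]_ : Series → ℕ → Series → Set
f ≈[ N ] g = ∀ n → n ≤ N → f n ≡ g n

truncated-setoid : ℕ → Setoid 0ℓ 0ℓ
truncated-setoid N = record
  { Carrier = Series
  ; _≈_ = _≈[ N ]_
  ; isEquivalence = record
    { refl = λ _ _ → refl
    ; sym = λ f≈g n n≤N → sym (f≈g n n≤N)
    ; trans = λ f≈g g≈h n n≤N → trans (f≈g n n≤N) (g≈h n n≤N)
    }
  }

module ≈-Reasoning (N : ℕ) = SetoidReasoning (truncated-setoid N)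

≗⇒≈ : ∀ {f g} N → f ≗ g → f ≈[ N ] g
≗⇒≈ N f≗g n _ = f≗g n

⊛-cong-≈ : ∀ {f f′ g g′ N} → f ≈[ N ] f′ → g ≈[ N ] g′ → f ⊛ g ≈[ N ] f′ ⊛ g′
⊛-cong-≈ f≈f′ g≈g′ n n≤N = sumBelow-cong (suc n) λ { i (s≤s i≤n) →
  cong₂ ℤ._*_ (f≈f′ i (ℕP.≤-trans i≤n n≤N)) (g≈g′ (n ∸ i) (ℕP.≤-trans (ℕP.m∸n≤m n i) n≤N)) }

inv-cong-≈ : ∀ f f′ N → f 0 ≡ 1ℤ → f′ 0 ≡ 1ℤ → f ≈[ N ] f′ → inv f ≈[ N ] inv f′
inv-cong-≈ f f′ N f0≡1 f′0≡1 f≈f′ = begin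
  inv f                   ≈⟨ ≗⇒≈ N (insertʳ {a = f′} {c = inv f′} (⊛-inverseʳ f′ f′0≡1) (inv f)) ⟩
  (inv f ⊛ f′) ⊛ inv f′   ≈⟨ ⊛-cong-≈ {g = inv f′} (⊛-cong-≈ {f = inv f} (λ _ _ → refl) (λ n n≤N → sym (f≈f′ n n≤N))) (λ _ _ → refl) ⟩
  (inv f ⊛ f) ⊛ inv f′    ≈⟨ ≗⇒≈ N (⊛-congʳ (inv f′) (⊛-inverseˡ f f0≡1)) ⟩
  sOne ⊛ inv f′           ≈⟨ ≗⇒≈ N (⊛-identityˡ (inv f′)) ⟩
  inv f′                  ∎
  where open ≈-Reasoning N

data Constraint : Set where
  free atLeast fewer : Constraint

-- Whether the weight j = c T of c parts of size T meets the constraint on the multiplicity c.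
allowedWeight : ℕ → Constraint → ℕ → ℕ → Bool
allowedWeight r free T j = true
allowedWeight r atLeast T j = ⌊ r ℕ.* T ℕ.≤? j ⌋
allowedWeight r fewer T j = ⌊ j ℕ.<? r ℕ.* T ⌋

block : ℕ → ℕ → Bool → List Part
block T zero b = []
block T (suc c) b = (T , b) ∷ replicate c (T , false)

blocks : ℕ → ℕ → List (List Part)
blocks T zero = [] ∷ []
blocks T (suc c) = block T (suc c) true ∷ block T (suc c) false ∷ []

-- Sizes are indexed from 0 here: M stands for the size suc M.
sizeBlocks : ℕ → Constraint → ℕ → ℕ → List (List Part)
sizeBlocks r τ M j =
  if ⌊ suc M ∣? j ⌋ ∧ allowedWeight r τ (suc M) j then blocks (suc M) (j / suc M) else []

sizeGF : ℕ → Constraint → ℕ → Series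
sizeGF r τ M j = + length (sizeBlocks r τ M j)

sizeGF-allowed : ∀ r τ M j → allowedWeight r τ (suc M) j ≡ true → sizeGF r τ M j ≡ sizeGF r free M j
sizeGF-allowed r τ M j allowed with suc M ∣? j
... | yes _ rewrite allowed = refl
... | no _ = refl

sizeGF-disallowed : ∀ r τ M j → allowedWeight r τ (suc M) j ≡ false → sizeGF r τ M j ≡ 0ℤ
sizeGF-disallowed r τ M j disallowed with suc M ∣? j
... | yes _ rewrite disallowed = refl
... | no _ = refl

sizeGF-∤ : ∀ r τ M j → ¬ suc M ∣ j → sizeGF r τ M j ≡ 0ℤ
sizeGF-∤ r τ M j T∤j with suc M ∣? j
... | yes T∣j = ⊥-elim (T∤j T∣j)
... | no _ = refl

sizeGF-free-0 : ∀ r M → sizeGF r free M 0 ≡ 1ℤ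
sizeGF-free-0 r M with suc M ∣? 0
... | yes _ = refl
... | no T∤0 = ⊥-elim (T∤0 (suc M ND.∣0))

sizeGF-free-∣ : ∀ r M j → suc M ∣ j → j ≢ 0 → sizeGF r free M j ≡ + 2
sizeGF-free-∣ r M j T∣j j≢0 with suc M ∣? j
... | no T∤j = ⊥-elim (T∤j T∣j)
... | yes _ = cong +_ (length-blocks (j / suc M) j/T≢0)
  where
  length-blocks : ∀ c → c ≢ 0 → length (blocks (suc M) c) ≡ 2
  length-blocks zero c≢0 = ⊥-elim (c≢0 refl)
  length-blocks (suc c) _ = refl
  j/T≢0 : j / suc M ≢ 0
  j/T≢0 j/T≡0 = ℕP.<⇒≱ (DM.m/n≡0⇒m<n j/T≡0) (ND.∣⇒≤ ⦃ ℕ.≢-nonZero j≢0 ⦄ T∣j)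

oneMinus : ℤ → ℕ → Series
oneMinus c E = sOne ⊖ mono c E

oneMinus-0 : ∀ c E → 1 ≤ E → oneMinus c E 0 ≡ 1ℤ
oneMinus-0 c E 1≤E = cong (λ x → 1ℤ ℤ.- x) (mono-off c E 0 (ℕP.<⇒≢ 1≤E))

oneMinus-at : ∀ c M → oneMinus c (suc M) (suc M) ≡ ℤ.- c
oneMinus-at c M = trans (cong (λ x → 0ℤ ℤ.- x) (mono-at c (suc M))) (ℤP.+-identityˡ (ℤ.- c))

oneMinus-off : ∀ c E n → n ≢ 0 → n ≢ E → oneMinus c E n ≡ 0ℤ
oneMinus-off c E zero n≢0 _ = ⊥-elim (n≢0 refl)
oneMinus-off c E (suc n) _ n≢E = cong (λ x → 0ℤ ℤ.- x) (mono-off c E (suc n) n≢E)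

oneMinus-cong : ∀ c {E E′} → E ≡ E′ → oneMinus c E ≗ oneMinus c E′
oneMinus-cong c refl _ = refl

⊛oneMinus-≥ : ∀ f c E n → E ≤ n → (f ⊛ oneMinus c E) n ≡ f n ℤ.- c ℤ.* f (n ∸ E)
⊛oneMinus-≥ f c E n E≤n = trans (⊛-distribˡ-⊖ f sOne (mono c E) n)
  (cong₂ ℤ._-_ (⊛-identityʳ f n) (trans (⊛-comm f (mono c E) n) (mono⊛-≥ c E f n E≤n)))

⊛oneMinus-< : ∀ f c E n → n < E → (f ⊛ oneMinus c E) n ≡ f n
⊛oneMinus-< f c E n n<E = trans (⊛-distribˡ-⊖ f sOne (mono c E) n)
  (trans (cong₂ ℤ._-_ (⊛-identityʳ f n) (trans (⊛-comm f (mono c E) n) (mono⊛-< c E f n n<E)))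
         (ℤP.+-identityʳ (f n)))

-- (1 + 2q^T + 2q^{2T} + …)(1 - q^T) = 1 + q^T; the 2 counts whether the first part of size T is overlined.
sizeGF-free⊛oneMinus : ∀ r M → sizeGF r free M ⊛ oneMinus 1ℤ (suc M) ≗ oneMinus (ℤ.- 1ℤ) (suc M)
sizeGF-free⊛oneMinus r M n with n ℕ.<? suc M
sizeGF-free⊛oneMinus r M zero | yes _ =
  trans (⊛oneMinus-< (sizeGF r free M) 1ℤ (suc M) zero (s≤s z≤n)) (sizeGF-free-0 r M)
sizeGF-free⊛oneMinus r M (suc n) | yes 1+n<T =
  trans (⊛oneMinus-< (sizeGF r free M) 1ℤ (suc M) (suc n) 1+n<T)
  (trans (sizeGF-∤ r free M (suc n) (λ T∣1+n → ℕP.<⇒≱ 1+n<T (ND.∣⇒≤ T∣1+n)))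
         (sym (oneMinus-off (ℤ.- 1ℤ) (suc M) (suc n) (λ ()) (ℕP.<⇒≢ 1+n<T))))
sizeGF-free⊛oneMinus r M n | no n≮T with n ∸ suc M | ℕP.m+[n∸m]≡n (ℕP.≮⇒≥ n≮T)
... | d | refl =
  trans (⊛oneMinus-≥ F 1ℤ T (T ℕ.+ d) (ℕP.m≤m+n T d))
  (trans (cong (λ k → F (T ℕ.+ d) ℤ.- 1ℤ ℤ.* F k) (ℕP.m+n∸m≡n T d)) (shift d (T ∣? d)))
  where
  T : ℕ
  T = suc M
  F : Series
  F = sizeGF r free M
  shift : ∀ d → Dec (T ∣ d) → F (T ℕ.+ d) ℤ.- 1ℤ ℤ.* F d ≡ oneMinus (ℤ.- 1ℤ) T (T ℕ.+ d)
  shift d (no T∤d) =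
    trans (cong₂ (λ x y → x ℤ.- 1ℤ ℤ.* y) (sizeGF-∤ r free M (T ℕ.+ d) (T∤d ∘ (λ T∣T+d → ND.∣m+n∣m⇒∣n T∣T+d ND.∣-refl)))
                                            (sizeGF-∤ r free M d T∤d))
          (sym (oneMinus-off (ℤ.- 1ℤ) T (T ℕ.+ d) (λ ()) (λ T+d≡T → T∤d (subst (T ∣_) (sym (ℕP.+-cancelˡ-≡ T d 0 (trans T+d≡T (sym (ℕP.+-identityʳ T))))) (T ND.∣0)))))
  shift zero (yes _) =
    trans (cong₂ (λ x y → x ℤ.- 1ℤ ℤ.* y) (trans (cong F (ℕP.+-identityʳ T)) (sizeGF-free-∣ r M T ND.∣-refl (λ ())))
                                            (sizeGF-free-0 r M))
          (sym (trans (cong (oneMinus (ℤ.- 1ℤ) T) (ℕP.+-identityʳ T)) (oneMinus-at (ℤ.- 1ℤ) M)))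
  shift (suc d) (yes T∣1+d) =
    trans (cong₂ (λ x y → x ℤ.- 1ℤ ℤ.* y) (sizeGF-free-∣ r M (T ℕ.+ suc d) (ND.∣m∣n⇒∣m+n ND.∣-refl T∣1+d) (λ ()))
                                            (sizeGF-free-∣ r M (suc d) T∣1+d (λ ())))
          (sym (oneMinus-off (ℤ.- 1ℤ) T (T ℕ.+ suc d) (λ ()) (ℕP.m+1+n≢m T)))

allowedWeight-atLeast : ∀ r T j → r ℕ.* T ≤ j → allowedWeight r atLeast T j ≡ true
allowedWeight-atLeast r T j rT≤j = trans (isYes≗does (r ℕ.* T ℕ.≤? j)) (dec-true (r ℕ.* T ℕ.≤? j) rT≤j)

allowedWeight-¬atLeast : ∀ r T j → j < r ℕ.* T → allowedWeight r atLeast T j ≡ false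
allowedWeight-¬atLeast r T j j<rT = trans (isYes≗does (r ℕ.* T ℕ.≤? j)) (dec-false (r ℕ.* T ℕ.≤? j) (ℕP.<⇒≱ j<rT))

allowedWeight-fewer : ∀ r T j → j < r ℕ.* T → allowedWeight r fewer T j ≡ true
allowedWeight-fewer r T j j<rT = trans (isYes≗does (j ℕ.<? r ℕ.* T)) (dec-true (j ℕ.<? r ℕ.* T) j<rT)

allowedWeight-¬fewer : ∀ r T j → r ℕ.* T ≤ j → allowedWeight r fewer T j ≡ false
allowedWeight-¬fewer r T j rT≤j = trans (isYes≗does (j ℕ.<? r ℕ.* T)) (dec-false (j ℕ.<? r ℕ.* T) (ℕP.≤⇒≯ rT≤j))

sizeGF-fewer⊕atLeast : ∀ r M → sizeGF r fewer M ⊕ sizeGF r atLeast M ≗ sizeGF r free M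
sizeGF-fewer⊕atLeast r M n with ℕP.≤-<-connex (r ℕ.* suc M) n
... | inj₁ rT≤n =
  trans (cong₂ ℤ._+_ (sizeGF-disallowed r fewer M n (allowedWeight-¬fewer r (suc M) n rT≤n))
                     (sizeGF-allowed r atLeast M n (allowedWeight-atLeast r (suc M) n rT≤n)))
        (ℤP.+-identityˡ _)
... | inj₂ n<rT =
  trans (cong₂ ℤ._+_ (sizeGF-allowed r fewer M n (allowedWeight-fewer r (suc M) n n<rT))
                     (sizeGF-disallowed r atLeast M n (allowedWeight-¬atLeast r (suc M) n n<rT)))
        (ℤP.+-identityʳ _)

sizeGF-atLeast-step : ∀ r .{{_ : ℕ.NonZero r}} M d →
  let T = suc M ; R = r ℕ.* suc M in
  sizeGF r free M (R ℕ.+ d) ℤ.- ℤ.- 1ℤ ℤ.* sizeGF r atLeast M (R ℕ.+ d ∸ T) ≡ + 2 ℤ.* sizeGF r free M d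
sizeGF-atLeast-step r M d = coefficient d (suc M ∣? d)
  where
  T : ℕ
  T = suc M
  R : ℕ
  R = r ℕ.* T
  F : Series
  F = sizeGF r free M
  H : Series
  H = sizeGF r atLeast M
  T≤R : T ≤ R
  T≤R = ℕP.m≤n*m T r
  T∣R : T ∣ R
  T∣R = ND.n∣m*n r
  R+j≢0 : ∀ j → R ℕ.+ j ≢ 0
  R+j≢0 j R+j≡0 = ℕ.≢-nonZero⁻¹ R {{ℕP.m*n≢0 r T}} (ℕP.m+n≡0⇒m≡0 R R+j≡0)
  coefficient : ∀ d → Dec (T ∣ d) → F (R ℕ.+ d) ℤ.- ℤ.- 1ℤ ℤ.* H (R ℕ.+ d ∸ T) ≡ + 2 ℤ.* F d
  coefficient d (no T∤d) = trans
    (cong₂ (λ x y → x ℤ.- ℤ.- 1ℤ ℤ.* y)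
           (sizeGF-∤ r free M (R ℕ.+ d) (T∤d ∘ (λ T∣R+d → ND.∣m+n∣m⇒∣n T∣R+d T∣R)))
           (sizeGF-∤ r atLeast M (R ℕ.+ d ∸ T)
              (T∤d ∘ (λ T∣R+d∸T → ND.∣m+n∣m⇒∣n (ND.∣m∸n∣n⇒∣m T (ℕP.≤-trans T≤R (ℕP.m≤m+n R d)) T∣R+d∸T ND.∣-refl) T∣R))))
    (sym (cong (+ 2 ℤ.*_) (sizeGF-∤ r free M d T∤d)))
  coefficient zero (yes _) = trans
    (cong₂ (λ x y → x ℤ.- ℤ.- 1ℤ ℤ.* y)
           (trans (cong F (ℕP.+-identityʳ R)) (sizeGF-free-∣ r M R T∣R (subst (_≢ 0) (ℕP.+-identityʳ R) (R+j≢0 0))))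
           (sizeGF-disallowed r atLeast M (R ℕ.+ 0 ∸ T) (allowedWeight-¬atLeast r T _ R+0∸T<R)))
    (sym (cong (+ 2 ℤ.*_) (sizeGF-free-0 r M)))
    where
    R+0∸T<R : R ℕ.+ 0 ∸ T < R
    R+0∸T<R = subst (λ x → x ∸ T < R) (sym (ℕP.+-identityʳ R)) (ℕP.∸-monoʳ-< {R} {T} {0} (s≤s z≤n) T≤R)
  coefficient (suc d) (yes T∣1+d) = trans
    (cong₂ (λ x y → x ℤ.- ℤ.- 1ℤ ℤ.* y)
           (sizeGF-free-∣ r M (R ℕ.+ suc d) (ND.∣m∣n⇒∣m+n T∣R T∣1+d) (R+j≢0 (suc d)))
           (trans (cong H (ℕP.+-∸-assoc R T≤1+d))
           (trans (sizeGF-allowed r atLeast M (R ℕ.+ (suc d ∸ T)) (allowedWeight-atLeast r T _ (ℕP.m≤m+n R _)))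
                  (sizeGF-free-∣ r M (R ℕ.+ (suc d ∸ T)) (ND.∣m∣n⇒∣m+n T∣R T∣1+d∸T) (R+j≢0 (suc d ∸ T))))))
    (sym (cong (+ 2 ℤ.*_) (sizeGF-free-∣ r M (suc d) T∣1+d (λ ()))))
    where
    T≤1+d : T ≤ suc d
    T≤1+d = ND.∣⇒≤ T∣1+d
    T∣1+d∸T : T ∣ suc d ∸ T
    T∣1+d∸T = ND.∣m+n∣m⇒∣n (subst (T ∣_) (sym (ℕP.m+[n∸m]≡n T≤1+d)) T∣1+d) ND.∣-refl

sizeGF-atLeast⊛oneMinus : ∀ r .{{_ : ℕ.NonZero r}} M →
  sizeGF r atLeast M ⊛ oneMinus (ℤ.- 1ℤ) (suc M) ≗ sizeGF r free M ⊛ mono (+ 2) (r ℕ.* suc M)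
sizeGF-atLeast⊛oneMinus r M n with ℕP.≤-<-connex (r ℕ.* suc M) n
... | inj₂ n<rT = trans lhs≡0 (sym (trans (⊛-comm F (mono (+ 2) R) n) (mono⊛-< (+ 2) R F n n<rT)))
  where
  T : ℕ
  T = suc M
  R : ℕ
  R = r ℕ.* T
  F : Series
  F = sizeGF r free M
  H : Series
  H = sizeGF r atLeast M
  H-below : ∀ j → j ≤ n → H j ≡ 0ℤ
  H-below j j≤n = sizeGF-disallowed r atLeast M j (allowedWeight-¬atLeast r T j (ℕP.≤-<-trans j≤n n<rT))
  lhs≡0 : (H ⊛ oneMinus (ℤ.- 1ℤ) T) n ≡ 0ℤ
  lhs≡0 with T ℕ.≤? n
  ... | no T≰n = trans (⊛oneMinus-< H (ℤ.- 1ℤ) T n (ℕP.≰⇒> T≰n)) (H-below n ℕP.≤-refl)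
  ... | yes T≤n = trans (⊛oneMinus-≥ H (ℤ.- 1ℤ) T n T≤n)
                   (cong₂ (λ x y → x ℤ.- ℤ.- 1ℤ ℤ.* y) (H-below n ℕP.≤-refl) (H-below (n ∸ T) (ℕP.m∸n≤m n T)))
... | inj₁ rT≤n with n ∸ r ℕ.* suc M | ℕP.m+[n∸m]≡n rT≤n
...   | d | refl = begin
    (H ⊛ oneMinus (ℤ.- 1ℤ) T) (R ℕ.+ d)
  ≡⟨ ⊛oneMinus-≥ H (ℤ.- 1ℤ) T (R ℕ.+ d) (ℕP.≤-trans T≤R (ℕP.m≤m+n R d)) ⟩
    H (R ℕ.+ d) ℤ.- ℤ.- 1ℤ ℤ.* H (R ℕ.+ d ∸ T)
  ≡⟨ cong (λ x → x ℤ.- ℤ.- 1ℤ ℤ.* H (R ℕ.+ d ∸ T)) (sizeGF-allowed r atLeast M (R ℕ.+ d) (allowedWeight-atLeast r T (R ℕ.+ d) (ℕP.m≤m+n R d))) ⟩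
    F (R ℕ.+ d) ℤ.- ℤ.- 1ℤ ℤ.* H (R ℕ.+ d ∸ T)
  ≡⟨ sizeGF-atLeast-step r M d ⟩
    + 2 ℤ.* F d
  ≡⟨ cong (λ k → + 2 ℤ.* F k) (ℕP.m+n∸m≡n R d) ⟨
    + 2 ℤ.* F (R ℕ.+ d ∸ R)
  ≡⟨ mono⊛-≥ (+ 2) R F (R ℕ.+ d) (ℕP.m≤m+n R d) ⟨
    (mono (+ 2) R ⊛ F) (R ℕ.+ d)
  ≡⟨ ⊛-comm (mono (+ 2) R) F (R ℕ.+ d) ⟩
    (F ⊛ mono (+ 2) R) (R ℕ.+ d)
  ∎
  where
  open ≡-Reasoning
  T : ℕ
  T = suc M
  R : ℕ
  R = r ℕ.* T
  F : Series
  F = sizeGF r free M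
  H : Series
  H = sizeGF r atLeast M
  T≤R : T ≤ R
  T≤R = ℕP.m≤n*m T r
productGF : ℕ → (ℕ → Constraint) → ℕ → Series
productGF r τ zero = sOne
productGF r τ (suc M) = sizeGF r (τ (suc M)) M ⊛ productGF r τ M

sizeGF-cong : ∀ r {τ τ′} M → τ ≡ τ′ → sizeGF r τ M ≗ sizeGF r τ′ M
sizeGF-cong r M refl _ = refl

productGF-cong : ∀ r τ₁ τ₂ M → (∀ t → 1 ≤ t → t ≤ M → τ₁ t ≡ τ₂ t) → productGF r τ₁ M ≗ productGF r τ₂ M
productGF-cong r τ₁ τ₂ zero _ _ = refl
productGF-cong r τ₁ τ₂ (suc M) agree =
  ⊛-cong (sizeGF-cong r M (agree (suc M) (s≤s z≤n) ℕP.≤-refl))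
         (productGF-cong r τ₁ τ₂ M (λ t 1≤t t≤M → agree t 1≤t (ℕP.m≤n⇒m≤1+n t≤M)))

productGF-replace : ∀ r τ₁ τ₂ t M {X Y} → 1 ≤ t → t ≤ M →
  (∀ s → 1 ≤ s → s ≤ M → s ≢ t → τ₁ s ≡ τ₂ s) →
  sizeGF r (τ₁ t) (t ∸ 1) ⊛ X ≗ sizeGF r (τ₂ t) (t ∸ 1) ⊛ Y →
  productGF r τ₁ M ⊛ X ≗ productGF r τ₂ M ⊛ Y
productGF-replace r τ₁ τ₂ (suc t′) (suc M) {X} {Y} 1≤t t≤1+M agree factor with M ℕ.≟ t′
... | yes refl = begin
  (F₁ ⊛ P₁) ⊛ X  ≈⟨ xy∙z≈xz∙y F₁ P₁ X ⟩
  (F₁ ⊛ X) ⊛ P₁  ≈⟨ ⊛-cong factor (productGF-cong r τ₁ τ₂ M below) ⟩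
  (F₂ ⊛ Y) ⊛ P₂  ≈⟨ xy∙z≈xz∙y F₂ Y P₂ ⟩
  (F₂ ⊛ P₂) ⊛ Y  ∎
  where
  open ≗-Reasoning
  F₁ : Series
  F₁ = sizeGF r (τ₁ (suc M)) M
  F₂ : Series
  F₂ = sizeGF r (τ₂ (suc M)) M
  P₁ : Series
  P₁ = productGF r τ₁ M
  P₂ : Series
  P₂ = productGF r τ₂ M
  below : ∀ t → 1 ≤ t → t ≤ M → τ₁ t ≡ τ₂ t
  below t 1≤t t≤M = agree t 1≤t (ℕP.m≤n⇒m≤1+n t≤M) (ℕP.<⇒≢ (s≤s t≤M))
... | no M≢t′ = begin
  (F₁ ⊛ P₁) ⊛ X  ≈⟨ ⊛-assoc F₁ P₁ X ⟩
  F₁ ⊛ (P₁ ⊛ X)  ≈⟨ ⊛-cong (sizeGF-cong r M (agree (suc M) (s≤s z≤n) ℕP.≤-refl (M≢t′ ∘ ℕP.suc-injective)))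
                          (productGF-replace r τ₁ τ₂ (suc t′) M {X} {Y} 1≤t t≤M (λ t 1≤t t≤M → agree t 1≤t (ℕP.m≤n⇒m≤1+n t≤M)) factor) ⟩
  F₂ ⊛ (P₂ ⊛ Y)  ≈⟨ ⊛-assoc F₂ P₂ Y ⟨
  (F₂ ⊛ P₂) ⊛ Y  ∎
  where
  open ≗-Reasoning
  F₁ : Series
  F₁ = sizeGF r (τ₁ (suc M)) M
  F₂ : Series
  F₂ = sizeGF r (τ₂ (suc M)) M
  P₁ : Series
  P₁ = productGF r τ₁ M
  P₂ : Series
  P₂ = productGF r τ₂ M
  t≤M : suc t′ ≤ M
  t≤M = ℕP.≤∧≢⇒< (ℕP.≤-pred t≤1+M) (M≢t′ ∘ sym)

productGF-additive : ∀ r τ₁ τ₂ τ t M → 1 ≤ t → t ≤ M →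
  (∀ s → 1 ≤ s → s ≤ M → s ≢ t → τ₁ s ≡ τ s × τ₂ s ≡ τ s) →
  sizeGF r (τ₁ t) (t ∸ 1) ⊕ sizeGF r (τ₂ t) (t ∸ 1) ≗ sizeGF r (τ t) (t ∸ 1) →
  productGF r τ₁ M ⊕ productGF r τ₂ M ≗ productGF r τ M
productGF-additive r τ₁ τ₂ τ (suc t′) (suc M) 1≤t t≤1+M agree factor with M ℕ.≟ t′
... | yes refl = begin
  F₁ ⊛ P₁ ⊕ F₂ ⊛ P₂  ≈⟨ ⊕-cong (⊛-congˡ F₁ (productGF-cong r τ₁ τ M (λ t 1≤t t≤M → proj₁ (below t 1≤t t≤M))))
                               (⊛-congˡ F₂ (productGF-cong r τ₂ τ M (λ t 1≤t t≤M → proj₂ (below t 1≤t t≤M)))) ⟩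
  F₁ ⊛ P ⊕ F₂ ⊛ P    ≈⟨ ⊛-distribʳ-⊕ P F₁ F₂ ⟨
  (F₁ ⊕ F₂) ⊛ P      ≈⟨ ⊛-congʳ P factor ⟩
  F ⊛ P              ∎
  where
  open ≗-Reasoning
  F₁ : Series
  F₁ = sizeGF r (τ₁ (suc M)) M
  F₂ : Series
  F₂ = sizeGF r (τ₂ (suc M)) M
  F : Series
  F = sizeGF r (τ (suc M)) M
  P₁ : Series
  P₁ = productGF r τ₁ M
  P₂ : Series
  P₂ = productGF r τ₂ M
  P : Series
  P = productGF r τ M
  below : ∀ t → 1 ≤ t → t ≤ M → τ₁ t ≡ τ t × τ₂ t ≡ τ t
  below t 1≤t t≤M = agree t 1≤t (ℕP.m≤n⇒m≤1+n t≤M) (ℕP.<⇒≢ (s≤s t≤M))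
... | no M≢t′ = begin
  F₁ ⊛ P₁ ⊕ F₂ ⊛ P₂  ≈⟨ ⊕-cong (⊛-congʳ P₁ (sizeGF-cong r M (proj₁ top))) (⊛-congʳ P₂ (sizeGF-cong r M (proj₂ top))) ⟩
  F ⊛ P₁ ⊕ F ⊛ P₂    ≈⟨ ⊛-distribˡ-⊕ F P₁ P₂ ⟨
  F ⊛ (P₁ ⊕ P₂)      ≈⟨ ⊛-congˡ F (productGF-additive r τ₁ τ₂ τ (suc t′) M 1≤t t≤M
                                     (λ t 1≤t t≤M → agree t 1≤t (ℕP.m≤n⇒m≤1+n t≤M)) factor) ⟩
  F ⊛ P              ∎
  where
  open ≗-Reasoning
  F₁ : Series
  F₁ = sizeGF r (τ₁ (suc M)) M
  F₂ : Series
  F₂ = sizeGF r (τ₂ (suc M)) M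
  F : Series
  F = sizeGF r (τ (suc M)) M
  P₁ : Series
  P₁ = productGF r τ₁ M
  P₂ : Series
  P₂ = productGF r τ₂ M
  P : Series
  P = productGF r τ M
  top : τ₁ (suc M) ≡ τ (suc M) × τ₂ (suc M) ≡ τ (suc M)
  top = agree (suc M) (s≤s z≤n) ℕP.≤-refl (M≢t′ ∘ ℕP.suc-injective)
  t≤M : suc t′ ≤ M
  t≤M = ℕP.≤∧≢⇒< (ℕP.≤-pred t≤1+M) (M≢t′ ∘ sym)

productGF-free : ∀ r τ M → (∀ t → 1 ≤ t → t ≤ M → τ t ≡ free) →
  productGF r τ M ⊛ pochFin 1ℤ 1 1 M ≗ pochFin (ℤ.- 1ℤ) 1 1 M
productGF-free r τ zero _ = ⊛-identityˡ sOne
productGF-free r τ (suc M) allFree = begin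
  (F ⊛ P) ⊛ (Q ⊛ oneMinus 1ℤ (1 ℕ.+ 1 ℕ.* M))
    ≈⟨ ⊛-cong (⊛-congʳ P (sizeGF-cong r M (allFree (suc M) (s≤s z≤n) ℕP.≤-refl)))
              (⊛-congˡ Q (oneMinus-cong 1ℤ 1+1*M≡1+M)) ⟩
  (G ⊛ P) ⊛ (Q ⊛ oneMinus 1ℤ (suc M))   ≈⟨ ⊛-congʳ (Q ⊛ oneMinus 1ℤ (suc M)) (⊛-comm G P) ⟩
  (P ⊛ G) ⊛ (Q ⊛ oneMinus 1ℤ (suc M))   ≈⟨ interchange P G Q (oneMinus 1ℤ (suc M)) ⟩
  (P ⊛ Q) ⊛ (G ⊛ oneMinus 1ℤ (suc M))
    ≈⟨ ⊛-cong (productGF-free r τ M (λ t 1≤t t≤M → allFree t 1≤t (ℕP.m≤n⇒m≤1+n t≤M)))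
              (sizeGF-free⊛oneMinus r M) ⟩
  pochFin (ℤ.- 1ℤ) 1 1 M ⊛ oneMinus (ℤ.- 1ℤ) (suc M)
    ≈⟨ ⊛-congˡ (pochFin (ℤ.- 1ℤ) 1 1 M) (oneMinus-cong (ℤ.- 1ℤ) 1+1*M≡1+M) ⟨
  pochFin (ℤ.- 1ℤ) 1 1 (suc M)  ∎
  where
  open ≗-Reasoning
  F : Series
  F = sizeGF r (τ (suc M)) M
  G : Series
  G = sizeGF r free M
  P : Series
  P = productGF r τ M
  Q : Series
  Q = pochFin 1ℤ 1 1 M
  1+1*M≡1+M : 1 ℕ.+ 1 ℕ.* M ≡ suc M
  1+1*M≡1+M = cong suc (ℕP.+-identityʳ M)

pochFin-0 : ∀ c e d k → 1 ≤ e → pochFin c e d k 0 ≡ 1ℤ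
pochFin-0 c e d zero _ = refl
pochFin-0 c e d (suc k) 1≤e = trans (⊛-constant (pochFin c e d k) (oneMinus c (e ℕ.+ d ℕ.* k)))
  (cong₂ ℤ._*_ (pochFin-0 c e d k 1≤e) (oneMinus-0 c (e ℕ.+ d ℕ.* k) (ℕP.≤-trans 1≤e (ℕP.m≤m+n e _))))

pochFin-stable : ∀ c j K → pochFin c 1 1 (suc j ℕ.+ K) j ≡ pochFin c 1 1 (suc j) j
pochFin-stable c j zero = cong (λ k → pochFin c 1 1 k j) (ℕP.+-identityʳ (suc j))
pochFin-stable c j (suc K) =
  trans (cong (λ k → pochFin c 1 1 k j) (ℕP.+-suc (suc j) K))
  (trans (⊛oneMinus-< (pochFin c 1 1 (suc j ℕ.+ K)) c (1 ℕ.+ 1 ℕ.* (suc j ℕ.+ K)) j j<exponent)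
         (pochFin-stable c j K))
  where
  j<exponent : j < 1 ℕ.+ 1 ℕ.* (suc j ℕ.+ K)
  j<exponent = s≤s (ℕP.≤-trans (ℕP.n≤1+n j) (ℕP.≤-trans (ℕP.m≤m+n (suc j) K) (ℕP.m≤n*m (suc j ℕ.+ K) 1)))

pochInf≈pochFin : ∀ c N → pochInf c 1 1 ≈[ N ] pochFin c 1 1 (suc N)
pochInf≈pochFin c N j j≤N =
  sym (trans (cong (λ k → pochFin c 1 1 (suc k) j) (sym (ℕP.m+[n∸m]≡n j≤N))) (pochFin-stable c j (N ∸ j)))

productGF-free≈overPartGF : ∀ r τ N → (∀ t → 1 ≤ t → t ≤ suc N → τ t ≡ free) →
  productGF r τ (suc N) ≈[ N ] overPartGF
productGF-free≈overPartGF r τ N allFree = begin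
  productGF r τ (suc N)                        ≈⟨ ≗⇒≈ N (insertʳ {a = Q} {c = inv Q} (⊛-inverseʳ Q Q0≡1) _) ⟩
  (productGF r τ (suc N) ⊛ Q) ⊛ inv Q          ≈⟨ ≗⇒≈ N (⊛-congʳ (inv Q) (productGF-free r τ (suc N) allFree)) ⟩
  pochFin (ℤ.- 1ℤ) 1 1 (suc N) ⊛ inv Q
    ≈⟨ ⊛-cong-≈ {g = inv Q} (λ n n≤N → sym (pochInf≈pochFin (ℤ.- 1ℤ) N n n≤N))
                (inv-cong-≈ Q (pochInf 1ℤ 1 1) N Q0≡1 (pochFin-0 1ℤ 1 1 1 ℕP.≤-refl)
                            (λ n n≤N → sym (pochInf≈pochFin 1ℤ N n n≤N))) ⟩
  overPartGF                                   ∎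
  where
  open ≈-Reasoning N
  Q : Series
  Q = pochFin 1ℤ 1 1 (suc N)
  Q0≡1 : Q 0 ≡ 1ℤ
  Q0≡1 = pochFin-0 1ℤ 1 1 (suc N) ℕP.≤-refl

nthResidue : ℕ → ℕ → ℕ → ℕ
nthResidue A a k = k ℕ.* A ℕ.+ a

1≤nthResidue : ∀ A a k → 1 ≤ a → 1 ≤ nthResidue A a k
1≤nthResidue A a k 1≤a = ℕP.≤-trans 1≤a (ℕP.m≤n+m a (k ℕ.* A))

exponent-suc : ∀ r A a k →
  r ℕ.* (A ℕ.* (suc k C 2) ℕ.+ suc k ℕ.* a) ≡ r ℕ.* (A ℕ.* (k C 2) ℕ.+ k ℕ.* a) ℕ.+ r ℕ.* nthResidue A a k
exponent-suc r A a k =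
  trans (cong (λ x → r ℕ.* (A ℕ.* x ℕ.+ suc k ℕ.* a)) C2-suc) (arithmetic r A a k (k C 2))
  where
  C2-suc : suc k C 2 ≡ k ℕ.+ k C 2
  C2-suc = trans (sym (NC.nCk+nC[k+1]≡[n+1]C[k+1] k 1)) (cong (ℕ._+ k C 2) (NC.nC1≡n k))
  arithmetic : ∀ r A a k x →
    r ℕ.* (A ℕ.* (k ℕ.+ x) ℕ.+ suc k ℕ.* a) ≡ r ℕ.* (A ℕ.* x ℕ.+ k ℕ.* a) ℕ.+ r ℕ.* (k ℕ.* A ℕ.+ a)
  arithmetic = ℕSolver.solve-∀

termT-zero : ∀ r A a → termT r A a 0 ≗ sOne
termT-zero r A a = begin
  mono (+ 1) (r ℕ.* (A ℕ.* 0 ℕ.+ 0)) ⊛ inv sOne  ≈⟨ ⊛-cong (mono-cong refl (sym exponent≡0)) (inv-unique sOne sOne refl (⊛-identityˡ sOne)) ⟨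
  sOne ⊛ sOne                                   ≈⟨ ⊛-identityˡ sOne ⟩
  sOne                                          ∎
  where
  open ≗-Reasoning
  exponent≡0 : r ℕ.* (A ℕ.* 0 ℕ.+ 0) ≡ 0
  exponent≡0 rewrite ℕP.*-zeroʳ A = ℕP.*-zeroʳ r

termT-suc : ∀ r A a k → 1 ≤ a →
  termT r A a (suc k) ⊛ oneMinus (ℤ.- 1ℤ) (nthResidue A a k) ≗ termT r A a k ⊛ mono (+ 2) (r ℕ.* nthResidue A a k)
termT-suc r A a k 1≤a = begin
  (q′ ⊛ inv (P ⊛ X′)) ⊛ X      ≈⟨ ⊛-congʳ X (⊛-congˡ q′ (inv-distrib-⊛ P X′ P0≡1 X′0≡1)) ⟩
  (q′ ⊛ (inv P ⊛ inv X′)) ⊛ X  ≈⟨ ⊛-congʳ X (⊛-assoc q′ (inv P) (inv X′)) ⟨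
  ((q′ ⊛ inv P) ⊛ inv X′) ⊛ X  ≈⟨ cancelʳ {a = inv X′} {c = X} inv-X′⊛X≗1 (q′ ⊛ inv P) ⟩
  q′ ⊛ inv P                   ≈⟨ ⊛-congʳ (inv P) q′≗q⊛Y ⟩
  (q ⊛ Y) ⊛ inv P              ≈⟨ xy∙z≈xz∙y q Y (inv P) ⟩
  (q ⊛ inv P) ⊛ Y              ∎
  where
  open ≗-Reasoning
  P : Series
  P = pochFin (ℤ.- 1ℤ) a A k
  X′ : Series
  X′ = oneMinus (ℤ.- 1ℤ) (a ℕ.+ A ℕ.* k)
  X : Series
  X = oneMinus (ℤ.- 1ℤ) (nthResidue A a k)
  q′ : Series
  q′ = mono (+ (2 ℕ.^ suc k)) (r ℕ.* (A ℕ.* (suc k C 2) ℕ.+ suc k ℕ.* a))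
  q : Series
  q = mono (+ (2 ℕ.^ k)) (r ℕ.* (A ℕ.* (k C 2) ℕ.+ k ℕ.* a))
  Y : Series
  Y = mono (+ 2) (r ℕ.* nthResidue A a k)
  P0≡1 : P 0 ≡ 1ℤ
  P0≡1 = pochFin-0 (ℤ.- 1ℤ) a A k 1≤a
  X′0≡1 : X′ 0 ≡ 1ℤ
  X′0≡1 = oneMinus-0 (ℤ.- 1ℤ) _ (ℕP.≤-trans 1≤a (ℕP.m≤m+n a _))
  inv-X′⊛X≗1 : inv X′ ⊛ X ≗ sOne
  inv-X′⊛X≗1 n = trans (⊛-congˡ (inv X′) (oneMinus-cong (ℤ.- 1ℤ) (sym X′≡X)) n) (⊛-inverseˡ X′ X′0≡1 n)
    where
    X′≡X : a ℕ.+ A ℕ.* k ≡ nthResidue A a k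
    X′≡X = trans (ℕP.+-comm a (A ℕ.* k)) (cong (ℕ._+ a) (ℕP.*-comm A k))
  q′≗q⊛Y : q′ ≗ q ⊛ Y
  q′≗q⊛Y n = trans (mono-cong (trans (cong +_ (ℕP.*-comm 2 (2 ℕ.^ k))) (ℤP.pos-* (2 ℕ.^ k) 2)) (exponent-suc r A a k) n)
                   (sym (mono⊛mono _ _ _ _ n))

countSize-∷-≡ : ∀ t b π → countSize t ((t , b) ∷ π) ≡ suc (countSize t π)
countSize-∷-≡ t b π = cong length (LP.filter-accept (λ p → size p ℕ.≟ t) {t , b} {π} refl)

countSize-∷-≢ : ∀ t v b π → v ≢ t → countSize t ((v , b) ∷ π) ≡ countSize t π
countSize-∷-≢ t v b π v≢t = cong length (LP.filter-reject (λ p → size p ℕ.≟ t) {v , b} {π} v≢t)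

countSize-++ : ∀ t π ρ → countSize t (π ++ ρ) ≡ countSize t π ℕ.+ countSize t ρ
countSize-++ t π ρ =
  trans (cong length (LP.filter-++ (λ p → size p ℕ.≟ t) π ρ)) (LP.length-++ (filter (λ p → size p ℕ.≟ t) π))

countSize-none : ∀ t π → All (λ p → size p ≢ t) π → countSize t π ≡ 0
countSize-none t [] [] = refl
countSize-none t ((v , b) ∷ π) (v≢t ∷ π≢t) = trans (countSize-∷-≢ t v b π v≢t) (countSize-none t π π≢t)

block-sizes : ∀ T c b → All (λ p → size p ≡ T) (block T c b)
block-sizes T zero b = []
block-sizes T (suc c) b = refl ∷ AllP.replicate⁺ c refl

countSize-block : ∀ T c b → countSize T (block T c b) ≡ c
countSize-block T zero b = refl
countSize-block T (suc c) b = trans (countSize-∷-≡ T b _) (cong suc (count-replicate c))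
  where
  count-replicate : ∀ c → countSize T (replicate c (T , false)) ≡ c
  count-replicate zero = refl
  count-replicate (suc c) = trans (countSize-∷-≡ T false _) (cong suc (count-replicate c))

countSize-block-≢ : ∀ T t c b → T ≢ t → countSize t (block T c b) ≡ 0
countSize-block-≢ T t c b T≢t = countSize-none t _ (All.map (λ size≡T size≡t → T≢t (trans (sym size≡T) size≡t)) (block-sizes T c b))

weight-++ : ∀ π ρ → weight (π ++ ρ) ≡ weight π ℕ.+ weight ρ
weight-++ π ρ = trans (cong sum (LP.map-++ size π ρ)) (ListActionP.sum-++ (map size π) (map size ρ))

size-≤-weight : ∀ π → All (λ p → size p ≤ weight π) π
size-≤-weight [] = []
size-≤-weight (p ∷ π) =
  ℕP.m≤m+n (size p) _ ∷ All.map (λ q≤w → ℕP.≤-trans q≤w (ℕP.m≤n+m _ (size p))) (size-≤-weight π)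

weight-block : ∀ T c b → weight (block T c b) ≡ c ℕ.* T
weight-block T zero b = refl
weight-block T (suc c) b = cong (T ℕ.+_) (weight-replicate c)
  where
  weight-replicate : ∀ c → weight (replicate c (T , false)) ≡ c ℕ.* T
  weight-replicate zero = refl
  weight-replicate (suc c) = cong (T ℕ.+_) (weight-replicate c)

sizes-≤-head : ∀ v b π → Linked ValidAdj ((v , b) ∷ π) → All (λ p → size p ≤ v) π
sizes-≤-head v b [] _ = []
sizes-≤-head v b ((w , c) ∷ π) ((w≤v , _) ∷ linked) =
  w≤v ∷ All.map (λ u≤w → ℕP.≤-trans u≤w w≤v) (sizes-≤-head w c π linked)

linked-∷ : ∀ p ρ → Linked ValidAdj ρ → All (λ q → size q < size p) ρ → Linked ValidAdj (p ∷ ρ)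
linked-∷ p [] _ _ = [-]
linked-∷ (v , b) ((w , c) ∷ ρ) linked (w<v ∷ _) = (ℕP.<⇒≤ w<v , (λ v≡w → ⊥-elim (ℕP.<-irrefl (sym v≡w) w<v))) ∷ linked

linked-block-++ : ∀ T c b ρ → Linked ValidAdj ρ → All (λ q → size q < T) ρ → Linked ValidAdj (block T c b ++ ρ)
linked-block-++ T zero b ρ linked _ = linked
linked-block-++ T (suc c) b ρ linked ρ<T = go c b
  where
  go : ∀ c b → Linked ValidAdj ((T , b) ∷ (replicate c (T , false) ++ ρ))
  go zero b = linked-∷ (T , b) ρ linked ρ<T
  go (suc c) b = (ℕP.≤-refl , (λ _ → refl)) ∷ go c false

record TopSplit (T : ℕ) (π : List Part) : Set where
  field
    overline : Bool
    rest : List Part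
    split : π ≡ block T (countSize T π) overline ++ rest
    rest<T : All (λ p → size p < T) rest
    rest-linked : Linked ValidAdj rest

topSplit : ∀ T π → Linked ValidAdj π → All (λ p → size p ≤ T) π → TopSplit T π
topSplit T [] _ _ = record { overline = false ; rest = [] ; split = refl ; rest<T = [] ; rest-linked = [] }
topSplit T ((v , b) ∷ π) linked (v≤T ∷ π≤T) with v ℕ.≟ T
... | no v≢T = record
  { overline = false ; rest = (v , b) ∷ π
  ; split = cong (λ c → block T c false ++ ((v , b) ∷ π)) (sym no-T)
  ; rest<T = v<T ∷ π<T ; rest-linked = linked }
  where
  v<T : v < T
  v<T = ℕP.≤∧≢⇒< v≤T v≢T
  π<T : All (λ p → size p < T) π
  π<T = All.map (λ u≤v → ℕP.≤-<-trans u≤v v<T) (sizes-≤-head v b π linked)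
  no-T : countSize T ((v , b) ∷ π) ≡ 0
  no-T = countSize-none T _ (v≢T ∷ All.map ℕP.<⇒≢ π<T)
... | yes refl = record
  { overline = b ; rest = S.rest ; split = split′ ; rest<T = S.rest<T ; rest-linked = S.rest-linked }
  where
  module S = TopSplit (topSplit v π (Lk.tail linked) π≤T)
  plain : ∀ c b′ → π ≡ block v c b′ ++ S.rest → block v c b′ ≡ replicate c (v , false)
  plain zero b′ _ = refl
  plain (suc c) b′ π≡ = cong (λ b″ → (v , b″) ∷ replicate c (v , false))
    (proj₂ (Lk.head (subst (λ ρ → Linked ValidAdj ((v , b) ∷ ρ)) π≡ linked)) refl)
  split′ : (v , b) ∷ π ≡ block v (countSize v ((v , b) ∷ π)) b ++ S.rest
  split′ = trans (cong ((v , b) ∷_) (trans S.split (cong (_++ S.rest) (plain (countSize v π) S.overline S.split))))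
                 (cong (λ c → block v c b ++ S.rest) (sym (countSize-∷-≡ v b π)))

concatBelow : ∀ {X : Set} → (ℕ → List X) → ℕ → List X
concatBelow g zero = []
concatBelow g (suc n) = concatBelow g n ++ g n

length-concatBelow : ∀ {X : Set} (g : ℕ → List X) n → + length (concatBelow g n) ≡ sumBelow (λ i → + length (g i)) n
length-concatBelow g zero = refl
length-concatBelow g (suc n) =
  trans (cong +_ (LP.length-++ (concatBelow g n)))
  (trans (ℤP.pos-+ (length (concatBelow g n)) (length (g n))) (cong (ℤ._+ + length (g n)) (length-concatBelow g n)))

∈-concatBelow⁻ : ∀ {X : Set} (g : ℕ → List X) n {x} → x ∈ concatBelow g n → ∃ λ i → i < n × x ∈ g i
∈-concatBelow⁻ g (suc n) x∈ with Mem.∈-++⁻ (concatBelow g n) x∈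
... | inj₁ x∈′ = let i , i<n , x∈gi = ∈-concatBelow⁻ g n x∈′ in i , ℕP.m<n⇒m<1+n i<n , x∈gi
... | inj₂ x∈gn = n , ℕP.≤-refl , x∈gn

∈-concatBelow⁺ : ∀ {X : Set} (g : ℕ → List X) n i {x} → i < n → x ∈ g i → x ∈ concatBelow g n
∈-concatBelow⁺ g (suc n) i i<1+n x∈gi with i ℕ.≟ n
... | yes refl = Mem.∈-++⁺ʳ (concatBelow g n) x∈gi
... | no i≢n = Mem.∈-++⁺ˡ (∈-concatBelow⁺ g n i (ℕP.≤∧≢⇒< (ℕP.≤-pred i<1+n) i≢n) x∈gi)

concatBelow-unique : ∀ {X : Set} (g : ℕ → List X) (key : X → ℕ) n →
  (∀ i → i < n → Unique (g i)) → (∀ i x → i < n → x ∈ g i → key x ≡ i) → Unique (concatBelow g n)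
concatBelow-unique g key zero _ _ = []
concatBelow-unique g key (suc n) unique keyed =
  UP.++⁺ (concatBelow-unique g key n (λ i i<n → unique i (ℕP.m<n⇒m<1+n i<n)) (λ i x i<n → keyed i x (ℕP.m<n⇒m<1+n i<n)))
         (unique n ℕP.≤-refl) disjoint
  where
  disjoint : Disjoint (concatBelow g n) (g n)
  disjoint (x∈below , x∈gn) with ∈-concatBelow⁻ g n x∈below
  ... | i , i<n , x∈gi = ℕP.<-irrefl (trans (sym (keyed i _ (ℕP.m<n⇒m<1+n i<n) x∈gi)) (keyed n _ ℕP.≤-refl x∈gn)) i<n

length-cartesianProductWith : ∀ {X Y Z : Set} (f : X → Y → Z) xs ys →
  length (cartesianProductWith f xs ys) ≡ length xs ℕ.* length ys
length-cartesianProductWith f [] ys = refl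
length-cartesianProductWith f (x ∷ xs) ys =
  trans (LP.length-++ (map (f x) ys)) (cong₂ ℕ._+_ (LP.length-map (f x) ys) (length-cartesianProductWith f xs ys))

blocks-++-unique : ∀ T c L → Unique L → Unique (cartesianProductWith _++_ (blocks T c) L)
blocks-++-unique T zero L unique = UP.++⁺ (UP.map⁺ id unique) [] (λ { (_ , ()) })
blocks-++-unique T (suc c) L unique =
  UP.++⁺ (UP.map⁺ (LP.++-cancelˡ (block T (suc c) true) _ _) unique)
         (UP.++⁺ (UP.map⁺ (LP.++-cancelˡ (block T (suc c) false) _ _) unique) [] (λ { (_ , ()) }))
         disjoint
  where
  disjoint : Disjoint (map (block T (suc c) true ++_) L) (map (block T (suc c) false ++_) L ++ [])
  disjoint (π∈₁ , π∈₂) with Mem.∈-map⁻ (block T (suc c) true ++_) π∈₁ | Mem.∈-++⁻ (map (block T (suc c) false ++_) L) π∈₂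
  ... | _ | inj₂ ()
  ... | _ , _ , π≡₁ | inj₁ π∈₂′ with Mem.∈-map⁻ (block T (suc c) false ++_) π∈₂′
  ...   | _ , _ , π≡₂ with cong proj₂ (LP.∷-injectiveˡ (trans (sym π≡₁) π≡₂))
  ...     | ()

∈-blocks⁻ : ∀ T c {β} → β ∈ blocks T c → ∃ λ b → β ≡ block T c b
∈-blocks⁻ T zero (here β≡[]) = false , β≡[]
∈-blocks⁻ T (suc c) (here β≡) = true , β≡
∈-blocks⁻ T (suc c) (there (here β≡)) = false , β≡

∈-blocks⁺ : ∀ T c b → block T c b ∈ blocks T c
∈-blocks⁺ T zero b = here refl
∈-blocks⁺ T (suc c) true = here refl
∈-blocks⁺ T (suc c) false = there (here refl)

∈-sizeBlocks⁻ : ∀ r τ M j {β} → β ∈ sizeBlocks r τ M j →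
  suc M ∣ j × allowedWeight r τ (suc M) j ≡ true × β ∈ blocks (suc M) (j / suc M)
∈-sizeBlocks⁻ r τ M j β∈ with suc M ∣? j | allowedWeight r τ (suc M) j
... | yes T∣j | true = T∣j , refl , β∈
∈-sizeBlocks⁻ r τ M j () | yes _ | false
∈-sizeBlocks⁻ r τ M j () | no _ | _

∈-sizeBlocks⁺ : ∀ r τ M j {β} → suc M ∣ j → allowedWeight r τ (suc M) j ≡ true →
  β ∈ blocks (suc M) (j / suc M) → β ∈ sizeBlocks r τ M j
∈-sizeBlocks⁺ r τ M j T∣j allowed β∈ with suc M ∣? j
... | no T∤j = ⊥-elim (T∤j T∣j)
... | yes _ rewrite allowed = β∈

sizeBlocks-unique : ∀ r τ M j L → Unique L → Unique (cartesianProductWith _++_ (sizeBlocks r τ M j) L)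
sizeBlocks-unique r τ M j L unique with suc M ∣? j | allowedWeight r τ (suc M) j
... | yes _ | true = blocks-++-unique (suc M) (j / suc M) L unique
... | yes _ | false = []
... | no _ | _ = []

Satisfies : ℕ → Constraint → ℕ → Set
Satisfies r free c = ⊤
Satisfies r atLeast c = r ≤ c
Satisfies r fewer c = c < r

allowedWeight⇒Satisfies : ∀ r τ T c → allowedWeight r τ (suc T) (c ℕ.* suc T) ≡ true → Satisfies r τ c
allowedWeight⇒Satisfies r free T c _ = tt
allowedWeight⇒Satisfies r atLeast T c allowed with r ℕ.* suc T ℕ.≤? c ℕ.* suc T
... | yes rT≤cT = ℕP.*-cancelʳ-≤ r c (suc T) rT≤cT
allowedWeight⇒Satisfies r atLeast T c () | no _
allowedWeight⇒Satisfies r fewer T c allowed with c ℕ.* suc T ℕ.<? r ℕ.* suc T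
... | yes cT<rT = ℕP.*-cancelʳ-< (suc T) c r cT<rT
allowedWeight⇒Satisfies r fewer T c () | no _

Satisfies⇒allowedWeight : ∀ r τ T c → Satisfies r τ c → allowedWeight r τ (suc T) (c ℕ.* suc T) ≡ true
Satisfies⇒allowedWeight r free T c _ = refl
Satisfies⇒allowedWeight r atLeast T c r≤c = allowedWeight-atLeast r (suc T) _ (ℕP.*-monoˡ-≤ (suc T) r≤c)
Satisfies⇒allowedWeight r fewer T c c<r = allowedWeight-fewer r (suc T) _ (ℕP.*-monoˡ-< (suc T) c<r)

Fits : ℕ → (ℕ → Constraint) → ℕ → ℕ → List Part → Set
Fits r τ M n π = IsOverpartition π × weight π ≡ n × All (λ p → size p ≤ M) π ×
                 (∀ t → 1 ≤ t → t ≤ M → Satisfies r (τ t) (countSize t π))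

fitting : ℕ → (ℕ → Constraint) → ℕ → ℕ → List (List Part)
fitting r τ zero zero = [] ∷ []
fitting r τ zero (suc n) = []
fitting r τ (suc M) n =
  concatBelow (λ j → cartesianProductWith _++_ (sizeBlocks r (τ (suc M)) M j) (fitting r τ M (n ∸ j))) (suc n)

length-fitting : ∀ r τ M n → + length (fitting r τ M n) ≡ productGF r τ M n
length-fitting r τ zero zero = refl
length-fitting r τ zero (suc n) = refl
length-fitting r τ (suc M) n = trans (length-concatBelow _ (suc n)) (sumBelow-cong (suc n) λ j _ →
  trans (cong +_ (length-cartesianProductWith _++_ (sizeBlocks r (τ (suc M)) M j) (fitting r τ M (n ∸ j))))
  (trans (ℤP.pos-* (length (sizeBlocks r (τ (suc M)) M j)) _)
         (cong (sizeGF r (τ (suc M)) M j ℤ.*_) (length-fitting r τ M (n ∸ j)))))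

fitting-sound : ∀ r τ M n π → π ∈ fitting r τ M n → Fits r τ M n π
fitting-sound r τ zero zero .[] (here refl) = ([] , []) , refl , [] , (λ t 1≤t t≤0 → ⊥-elim (ℕP.<⇒≱ 1≤t t≤0))
fitting-sound r τ (suc M) n π π∈ with ∈-concatBelow⁻ _ (suc n) π∈
... | j , s≤s j≤n , π∈j
  with Mem.∈-cartesianProductWith⁻ _++_ (sizeBlocks r (τ (suc M)) M j) (fitting r τ M (n ∸ j)) π∈j
... | β , ρ , β∈ , ρ∈ , refl with ∈-sizeBlocks⁻ r (τ (suc M)) M j β∈
... | T∣j , allowed , β∈blocks with ∈-blocks⁻ (suc M) (j / suc M) β∈blocks
... | b , refl = (positive , linked) , weight≡n , sizes≤T , satisfies
  where
  T : ℕ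
  T = suc M
  c : ℕ
  c = j / T
  ρ-fits : Fits r τ M (n ∸ j) ρ
  ρ-fits = fitting-sound r τ M (n ∸ j) ρ ρ∈
  ρ≤M : All (λ p → size p ≤ M) ρ
  ρ≤M = proj₁ (proj₂ (proj₂ ρ-fits))
  ρ<T : All (λ p → size p < T) ρ
  ρ<T = All.map s≤s ρ≤M
  c*T≡j : c ℕ.* T ≡ j
  c*T≡j = DM.m/n*n≡m T∣j
  positive : All (λ p → 1 ≤ size p) (block T c b ++ ρ)
  positive = AllP.++⁺ (All.map (λ size≡T → subst (1 ≤_) (sym size≡T) (s≤s z≤n)) (block-sizes T c b)) (proj₁ (proj₁ ρ-fits))
  linked : Linked ValidAdj (block T c b ++ ρ)
  linked = linked-block-++ T c b ρ (proj₂ (proj₁ ρ-fits)) ρ<T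
  weight≡n : weight (block T c b ++ ρ) ≡ n
  weight≡n = trans (weight-++ (block T c b) ρ)
    (trans (cong₂ ℕ._+_ (trans (weight-block T c b) c*T≡j) (proj₁ (proj₂ ρ-fits))) (ℕP.m+[n∸m]≡n j≤n))
  sizes≤T : All (λ p → size p ≤ T) (block T c b ++ ρ)
  sizes≤T = AllP.++⁺ (All.map ℕP.≤-reflexive (block-sizes T c b)) (All.map ℕP.m≤n⇒m≤1+n ρ≤M)
  satisfies : ∀ t → 1 ≤ t → t ≤ T → Satisfies r (τ t) (countSize t (block T c b ++ ρ))
  satisfies t 1≤t t≤T with t ℕ.≟ T
  ... | yes refl = subst (Satisfies r (τ T))
    (sym (trans (countSize-++ T (block T c b) ρ)
         (trans (cong₂ ℕ._+_ (countSize-block T c b) (countSize-none T ρ (All.map ℕP.<⇒≢ ρ<T))) (ℕP.+-identityʳ c))))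
    (allowedWeight⇒Satisfies r (τ T) M c (subst (λ i → allowedWeight r (τ T) T i ≡ true) (sym c*T≡j) allowed))
  ... | no t≢T = subst (Satisfies r (τ t))
    (sym (trans (countSize-++ t (block T c b) ρ) (cong (ℕ._+ countSize t ρ) (countSize-block-≢ T t c b (t≢T ∘ sym)))))
    (proj₂ (proj₂ (proj₂ ρ-fits)) t 1≤t (ℕP.≤-pred (ℕP.≤∧≢⇒< t≤T t≢T)))

fitting-complete : ∀ r τ M n π → Fits r τ M n π → π ∈ fitting r τ M n
fitting-complete r τ zero n [] (_ , refl , _ , _) = here refl
fitting-complete r τ zero n (_ ∷ _) ((1≤p ∷ _ , _) , _ , p≤0 ∷ _ , _) = ⊥-elim (ℕP.<⇒≱ 1≤p p≤0)
fitting-complete r τ (suc M) n π ((positive , linked) , weight≡n , sizes≤T , satisfies) =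
  subst (_∈ fitting r τ (suc M) n) (sym S.split)
    (∈-concatBelow⁺ _ (suc n) j (s≤s j≤n)
      (Mem.∈-cartesianProductWith⁺ _++_ {xs = sizeBlocks r (τ T) M j} β∈ (fitting-complete r τ M (n ∸ j) S.rest rest-fits)))
  where
  T : ℕ
  T = suc M
  module S = TopSplit (topSplit T π linked sizes≤T)
  c : ℕ
  c = countSize T π
  β : List Part
  β = block T c S.overline
  j : ℕ
  j = c ℕ.* T
  j+rest≡n : j ℕ.+ weight S.rest ≡ n
  j+rest≡n = trans (cong (ℕ._+ weight S.rest) (sym (weight-block T c S.overline)))
                   (trans (sym (weight-++ β S.rest)) (trans (cong weight (sym S.split)) weight≡n))
  j≤n : j ≤ n
  j≤n = subst (j ≤_) j+rest≡n (ℕP.m≤m+n j _)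
  count-rest : ∀ t → t ≢ T → countSize t π ≡ countSize t S.rest
  count-rest t t≢T = trans (cong (countSize t) S.split)
    (trans (countSize-++ t β S.rest) (cong (ℕ._+ countSize t S.rest) (countSize-block-≢ T t c S.overline (t≢T ∘ sym))))
  rest-fits : Fits r τ M (n ∸ j) S.rest
  rest-fits =
    (AllP.++⁻ʳ β (subst (All (λ p → 1 ≤ size p)) S.split positive) , S.rest-linked) ,
    trans (sym (ℕP.m+n∸m≡n j (weight S.rest))) (cong (_∸ j) j+rest≡n) ,
    All.map ℕP.≤-pred S.rest<T ,
    (λ t 1≤t t≤M → subst (Satisfies r (τ t)) (count-rest t (ℕP.<⇒≢ (s≤s t≤M))) (satisfies t 1≤t (ℕP.m≤n⇒m≤1+n t≤M)))
  β∈ : β ∈ sizeBlocks r (τ T) M j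
  β∈ = ∈-sizeBlocks⁺ r (τ T) M j (ND.n∣m*n c) (Satisfies⇒allowedWeight r (τ T) M c (satisfies T (s≤s z≤n) ℕP.≤-refl))
         (subst (λ c′ → β ∈ blocks T c′) (sym (DM.m*n/n≡m c T)) (∈-blocks⁺ T c S.overline))

∈-fitting⇔Fits : ∀ r τ M n π → π ∈ fitting r τ M n ⇔ Fits r τ M n π
∈-fitting⇔Fits r τ M n π = mk⇔ (fitting-sound r τ M n π) (fitting-complete r τ M n π)

fitting-unique : ∀ r τ M n → Unique (fitting r τ M n)
fitting-unique r τ zero zero = [] ∷ []
fitting-unique r τ zero (suc n) = []
fitting-unique r τ (suc M) n = concatBelow-unique _ key (suc n)
  (λ j _ → sizeBlocks-unique r (τ (suc M)) M j _ (fitting-unique r τ M (n ∸ j))) keyed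
  where
  T : ℕ
  T = suc M
  key : List Part → ℕ
  key π = countSize T π ℕ.* T
  keyed : ∀ j π → j < suc n → π ∈ cartesianProductWith _++_ (sizeBlocks r (τ T) M j) (fitting r τ M (n ∸ j)) → key π ≡ j
  keyed j π _ π∈ with Mem.∈-cartesianProductWith⁻ _++_ (sizeBlocks r (τ T) M j) (fitting r τ M (n ∸ j)) π∈
  ... | β , ρ , β∈ , ρ∈ , refl with ∈-sizeBlocks⁻ r (τ T) M j β∈
  ... | T∣j , _ , β∈blocks with ∈-blocks⁻ T (j / T) β∈blocks
  ... | b , refl = trans (cong (ℕ._* T) count) (DM.m/n*n≡m T∣j)
    where
    ρ<T : All (λ p → size p < T) ρ
    ρ<T = All.map s≤s (proj₁ (proj₂ (proj₂ (fitting-sound r τ M (n ∸ j) ρ ρ∈))))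
    count : countSize T (block T (j / T) b ++ ρ) ≡ j / T
    count = trans (countSize-++ T (block T (j / T) b) ρ)
      (trans (cong₂ ℕ._+_ (countSize-block T (j / T) b) (countSize-none T ρ (All.map ℕP.<⇒≢ ρ<T))) (ℕP.+-identityʳ _))

∣t-a∣≡t∸a : ∀ t a → a ≤ t → ℤ.∣ + t ℤ.- + a ∣ ≡ t ∸ a
∣t-a∣≡t∸a t a a≤t = trans (cong ℤ.∣_∣ (ℤP.m-n≡m⊖n t a)) (trans (ℤP.∣m⊖n∣≡∣n⊖m∣ t a) (ℤP.∣⊖∣-≤ a≤t))

∣t-a∣≡a∸t : ∀ t a → t ≤ a → ℤ.∣ + t ℤ.- + a ∣ ≡ a ∸ t
∣t-a∣≡a∸t t a t≤a = trans (cong ℤ.∣_∣ (ℤP.m-n≡m⊖n t a)) (ℤP.∣⊖∣-≤ t≤a)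

congruent? : ∀ t a A → Dec (t ≡ a [mod A ])
congruent? t a A = A ∣? ℤ.∣ + t ℤ.- + a ∣

module Progression (A a : ℕ) (1≤a : 1 ≤ a) (a≤A : a ≤ A) where

  m : ℕ → ℕ
  m = nthResidue A a

  m<m-suc : ∀ k → m k < m (suc k)
  m<m-suc k = subst (m k <_) (sym (ℕP.+-assoc A (k ℕ.* A) a)) (ℕP.m<n+m (m k) (ℕP.≤-trans 1≤a a≤A))

  m-congruent : ∀ k → m k ≡ a [mod A ]
  m-congruent k = subst (A ∣_) (sym (trans (∣t-a∣≡t∸a (m k) a (ℕP.m≤n+m a (k ℕ.* A))) (ℕP.m+n∸n≡m (k ℕ.* A) a)))
                        (ND.n∣m*n k)

  ¬congruent-below-a : ∀ t → 1 ≤ t → t < a → ¬ t ≡ a [mod A ]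
  ¬congruent-below-a t 1≤t t<a A∣a∸t = ℕP.<-irrefl refl (ℕP.<-≤-trans (ℕP.≤-<-trans A≤a∸t a∸t<a) a≤A)
    where
    A≤a∸t : A ≤ a ∸ t
    A≤a∸t = ND.∣⇒≤ ⦃ ℕ.≢-nonZero (ℕP.<⇒≢ (ℕP.m<n⇒0<n∸m t<a) ∘ sym) ⦄ (subst (A ∣_) (∣t-a∣≡a∸t t a (ℕP.<⇒≤ t<a)) A∣a∸t)
    a∸t<a : a ∸ t < a
    a∸t<a = ℕP.∸-monoʳ-< {a} {t} {0} 1≤t (ℕP.<⇒≤ t<a)

  ¬congruent-between : ∀ k t → m k < t → t < m (suc k) → ¬ t ≡ a [mod A ]
  ¬congruent-between k t m<t t<m′ A∣t-a = no-multiple (subst (A ∣_) (∣t-a∣≡t∸a t a a≤t) A∣t-a)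
    where
    a≤t : a ≤ t
    a≤t = ℕP.≤-trans (ℕP.m≤n+m a (k ℕ.* A)) (ℕP.<⇒≤ m<t)
    t∸a+a≡t : t ∸ a ℕ.+ a ≡ t
    t∸a+a≡t = ℕP.m∸n+n≡m a≤t
    no-multiple : ¬ A ∣ t ∸ a
    no-multiple (ND.divides z t∸a≡z*A) = ℕP.<-irrefl refl
      (ℕP.<-≤-trans (ℕP.*-cancelʳ-< A k z k*A<z*A) (ℕP.≤-pred (ℕP.*-cancelʳ-< A z (suc k) z*A<1+k*A)))
      where
      k*A<z*A : k ℕ.* A < z ℕ.* A
      k*A<z*A = subst (k ℕ.* A <_) t∸a≡z*A (ℕP.+-cancelʳ-< a (k ℕ.* A) (t ∸ a) (subst (m k <_) (sym t∸a+a≡t) m<t))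
      z*A<1+k*A : z ℕ.* A < suc k ℕ.* A
      z*A<1+k*A = subst (_< suc k ℕ.* A) t∸a≡z*A
                    (ℕP.+-cancelʳ-< a (t ∸ a) (suc k ℕ.* A) (subst (_< m (suc k)) (sym t∸a+a≡t) t<m′))

  -- Sizes m 0, …, m (k - 1) must occur at least r times: the profile of mes ≥ m k.
  mesAtLeast : ℕ → ℕ → Constraint
  mesAtLeast k t = if ⌊ t ℕ.<? m k ⌋ ∧ ⌊ congruent? t a A ⌋ then atLeast else free

  mesExactly : ℕ → ℕ → Constraint
  mesExactly k t = if ⌊ t ℕ.≟ m k ⌋ then fewer else mesAtLeast k t

  mesAtLeast-zero : ∀ t → 1 ≤ t → mesAtLeast 0 t ≡ free
  mesAtLeast-zero t 1≤t with t ℕ.<? a | congruent? t a A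
  ... | yes t<a | yes t≡a = ⊥-elim (¬congruent-below-a t 1≤t t<a t≡a)
  ... | yes _ | no _ = refl
  ... | no _ | _ = refl

  mesAtLeast-at : ∀ k → mesAtLeast k (m k) ≡ free
  mesAtLeast-at k with m k ℕ.<? m k
  ... | yes m<m = ⊥-elim (ℕP.<-irrefl refl m<m)
  ... | no _ = refl

  mesAtLeast-suc-at : ∀ k → mesAtLeast (suc k) (m k) ≡ atLeast
  mesAtLeast-suc-at k with m k ℕ.<? m (suc k) | congruent? (m k) a A
  ... | yes _ | yes _ = refl
  ... | yes _ | no ¬congruent = ⊥-elim (¬congruent (m-congruent k))
  ... | no m≮m′ | _ = ⊥-elim (m≮m′ (m<m-suc k))

  mesAtLeast-suc : ∀ k t → t ≢ m k → mesAtLeast (suc k) t ≡ mesAtLeast k t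
  mesAtLeast-suc k t t≢m with t ℕ.<? m (suc k) | t ℕ.<? m k | congruent? t a A
  ... | yes _ | yes _ | yes _ = refl
  ... | yes t<m′ | no t≮m | yes t≡a =
    ⊥-elim (¬congruent-between k t (ℕP.≤∧≢⇒< (ℕP.≮⇒≥ t≮m) (t≢m ∘ sym)) t<m′ t≡a)
  ... | no t≮m′ | yes t<m | _ = ⊥-elim (t≮m′ (ℕP.<-trans t<m (m<m-suc k)))
  ... | no _ | no _ | _ = refl
  ... | yes _ | yes _ | no _ = refl
  ... | yes _ | no _ | no _ = refl

  mesExactly-at : ∀ k → mesExactly k (m k) ≡ fewer
  mesExactly-at k with m k ℕ.≟ m k
  ... | yes _ = refl
  ... | no m≢m = ⊥-elim (m≢m refl)

  mesExactly-off : ∀ k t → t ≢ m k → mesExactly k t ≡ mesAtLeast k t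
  mesExactly-off k t t≢m with t ℕ.≟ m k
  ... | yes t≡m = ⊥-elim (t≢m t≡m)
  ... | no _ = refl

  module _ (r : ℕ) .{{_ : ℕ.NonZero r}} (N : ℕ) where

    productGF-mesAtLeast : ∀ k → m k ≤ suc N ℕ.+ A →
      productGF r (mesAtLeast k) (suc N) ≈[ N ] overPartGF ⊛ termT r A a k
    productGF-mesAtLeast zero _ = begin
      productGF r (mesAtLeast 0) (suc N)
        ≈⟨ productGF-free≈overPartGF r (mesAtLeast 0) N (λ t 1≤t _ → mesAtLeast-zero t 1≤t) ⟩
      overPartGF                  ≈⟨ ≗⇒≈ N (⊛-identityʳ overPartGF) ⟨
      overPartGF ⊛ sOne           ≈⟨ ≗⇒≈ N (⊛-congˡ overPartGF (termT-zero r A a)) ⟨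
      overPartGF ⊛ termT r A a 0  ∎
      where open ≈-Reasoning N
    productGF-mesAtLeast (suc k) m′≤D+A = begin
      P′                        ≈⟨ ≗⇒≈ N (insertʳ {a = X} {c = inv X} (⊛-inverseʳ X X0≡1) P′) ⟩
      (P′ ⊛ X) ⊛ inv X          ≈⟨ ≗⇒≈ N (⊛-congʳ (inv X) (productGF-replace r (mesAtLeast (suc k)) (mesAtLeast k)
                                     (m k) D {X} {Y} 1≤m m≤D (λ t _ _ t≢m → mesAtLeast-suc k t t≢m) factor)) ⟩
      (P ⊛ Y) ⊛ inv X           ≈⟨ ⊛-cong-≈ {g = inv X} (⊛-cong-≈ {g = Y} (productGF-mesAtLeast k m≤D+A) (λ _ _ → refl))
                                            (λ _ _ → refl) ⟩
      ((G ⊛ T) ⊛ Y) ⊛ inv X     ≈⟨ ≗⇒≈ N (⊛-congʳ (inv X) (⊛-assoc G T Y)) ⟩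
      (G ⊛ (T ⊛ Y)) ⊛ inv X     ≈⟨ ≗⇒≈ N (⊛-congʳ (inv X) (⊛-congˡ G (termT-suc r A a k 1≤a))) ⟨
      (G ⊛ (T′ ⊛ X)) ⊛ inv X    ≈⟨ ≗⇒≈ N (⊛-congʳ (inv X) (⊛-assoc G T′ X)) ⟨
      ((G ⊛ T′) ⊛ X) ⊛ inv X    ≈⟨ ≗⇒≈ N (cancelʳ {a = X} {c = inv X} (⊛-inverseʳ X X0≡1) (G ⊛ T′)) ⟩
      G ⊛ T′                    ∎
      where
      open ≈-Reasoning N
      D : ℕ
      D = suc N
      P : Series
      P = productGF r (mesAtLeast k) D
      P′ : Series
      P′ = productGF r (mesAtLeast (suc k)) D
      G : Series
      G = overPartGF
      T : Series
      T = termT r A a k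
      T′ : Series
      T′ = termT r A a (suc k)
      X : Series
      X = oneMinus (ℤ.- 1ℤ) (m k)
      Y : Series
      Y = mono (+ 2) (r ℕ.* m k)
      1≤m : 1 ≤ m k
      1≤m = 1≤nthResidue A a k 1≤a
      X0≡1 : X 0 ≡ 1ℤ
      X0≡1 = oneMinus-0 (ℤ.- 1ℤ) (m k) 1≤m
      m≤D : m k ≤ D
      m≤D = ℕP.+-cancelˡ-≤ A (m k) D (subst (_≤ A ℕ.+ D) (ℕP.+-assoc A (k ℕ.* A) a) (subst (m (suc k) ≤_) (ℕP.+-comm D A) m′≤D+A))
      m≤D+A : m k ≤ D ℕ.+ A
      m≤D+A = ℕP.≤-trans m≤D (ℕP.m≤m+n D A)
      factor : sizeGF r (mesAtLeast (suc k) (m k)) (m k ∸ 1) ⊛ X ≗ sizeGF r (mesAtLeast k (m k)) (m k ∸ 1) ⊛ Y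
      factor rewrite mesAtLeast-suc-at k | mesAtLeast-at k =
        subst (λ t → sizeGF r atLeast (m k ∸ 1) ⊛ oneMinus (ℤ.- 1ℤ) t ≗ sizeGF r free (m k ∸ 1) ⊛ mono (+ 2) (r ℕ.* t))
              (ℕP.m+[n∸m]≡n 1≤m) (sizeGF-atLeast⊛oneMinus r (m k ∸ 1))

    productGF-mesExactly : ∀ k → m k ≤ N → productGF r (mesExactly k) (suc N) ≈[ N ] overPartGF ⊛ bracket r A a k
    productGF-mesExactly k m≤N n n≤N = begin
      productGF r (mesExactly k) D n
        ≡⟨ ⊕⇒⊖ (productGF r (mesExactly k) D) (productGF r (mesAtLeast (suc k)) D) (productGF-additive r (mesExactly k) (mesAtLeast (suc k)) (mesAtLeast k) (m k) D 1≤m m≤D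
                  (λ t _ _ t≢m → mesExactly-off k t t≢m , mesAtLeast-suc k t t≢m) factor) n ⟩
      productGF r (mesAtLeast k) D n ℤ.- productGF r (mesAtLeast (suc k)) D n
        ≡⟨ cong₂ ℤ._-_ (productGF-mesAtLeast k (ℕP.≤-trans m≤D (ℕP.m≤m+n D A)) n n≤N)
                       (productGF-mesAtLeast (suc k) m′≤D+A n n≤N) ⟩
      (overPartGF ⊛ termT r A a k) n ℤ.- (overPartGF ⊛ termT r A a (suc k)) n
        ≡⟨ ⊛-distribˡ-⊖ overPartGF (termT r A a k) (termT r A a (suc k)) n ⟨
      (overPartGF ⊛ bracket r A a k) n
        ∎
      where
      open ≡-Reasoning
      D : ℕ
      D = suc N
      1≤m : 1 ≤ m k
      1≤m = 1≤nthResidue A a k 1≤a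
      m≤D : m k ≤ D
      m≤D = ℕP.m≤n⇒m≤1+n m≤N
      m′≤D+A : m (suc k) ≤ D ℕ.+ A
      m′≤D+A = subst (_≤ D ℕ.+ A) (sym (ℕP.+-assoc A (k ℕ.* A) a))
                     (subst (A ℕ.+ m k ≤_) (ℕP.+-comm A D) (ℕP.+-monoʳ-≤ A m≤D))
      factor : sizeGF r (mesExactly k (m k)) (m k ∸ 1) ⊕ sizeGF r (mesAtLeast (suc k) (m k)) (m k ∸ 1)
             ≗ sizeGF r (mesAtLeast k (m k)) (m k ∸ 1)
      factor rewrite mesExactly-at k | mesAtLeast-suc-at k | mesAtLeast-at k = sizeGF-fewer⊕atLeast r (m k ∸ 1)

  private instance
    A≢0 : ℕ.NonZero A
    A≢0 = ℕ.>-nonZero (ℕP.≤-trans 1≤a a≤A)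

  congruent⇒nthResidue : ∀ t → 1 ≤ t → t ≡ a [mod A ] → ∃ λ k → m k ≡ t
  congruent⇒nthResidue t 1≤t t≡a with ℕP.≤-<-connex a t
  ... | inj₂ t<a = ⊥-elim (¬congruent-below-a t 1≤t t<a t≡a)
  ... | inj₁ a≤t with subst (A ∣_) (∣t-a∣≡t∸a t a a≤t) t≡a
  ...   | ND.divides k t∸a≡k*A = k , trans (cong (ℕ._+ a) (sym t∸a≡k*A)) (ℕP.m∸n+n≡m a≤t)

  zCoeffSum-nthResidue : ∀ r k → zCoeffSum r A a (m k) ≗ bracket r A a k
  zCoeffSum-nthResidue r k n′ = trans (sumBelow-single _ (suc (m k)) k (s≤s k≤m) others) selected
    where
    k≤m : k ≤ m k
    k≤m = ℕP.≤-trans (ℕP.m≤m*n k A) (ℕP.m≤m+n (k ℕ.* A) a)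
    summand : ℕ → ℤ
    summand j = if ⌊ j ℕ.* A ℕ.+ a ℕ.≟ m k ⌋ then bracket r A a j n′ else 0ℤ
    others : ∀ j → j < suc (m k) → j ≢ k → summand j ≡ 0ℤ
    others j _ j≢k with j ℕ.* A ℕ.+ a ℕ.≟ m k
    ... | yes mj≡mk = ⊥-elim (j≢k (ℕP.*-cancelʳ-≡ j k A (ℕP.+-cancelʳ-≡ a _ _ mj≡mk)))
    ... | no _ = refl
    selected : summand k ≡ bracket r A a k n′
    selected with m k ℕ.≟ m k
    ... | yes _ = refl
    ... | no mk≢mk = ⊥-elim (mk≢mk refl)

  zCoeffSum-non-residue : ∀ r t → (∀ k → m k ≢ t) → zCoeffSum r A a t ≗ sZero
  zCoeffSum-non-residue r t ¬residue n′ = sumBelow-zero _ (suc t) summand≡0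
    where
    summand≡0 : ∀ j → j < suc t → (if ⌊ j ℕ.* A ℕ.+ a ℕ.≟ t ⌋ then bracket r A a j n′ else 0ℤ) ≡ 0ℤ
    summand≡0 j _ with j ℕ.* A ℕ.+ a ℕ.≟ t
    ... | yes mj≡t = ⊥-elim (¬residue j mj≡t)
    ... | no _ = refl

  mesAtLeast-atLeast : ∀ k t → t < m k → t ≡ a [mod A ] → mesAtLeast k t ≡ atLeast
  mesAtLeast-atLeast k t t<m t≡a with t ℕ.<? m k | congruent? t a A
  ... | yes _ | yes _ = refl
  ... | yes _ | no t≢a = ⊥-elim (t≢a t≡a)
  ... | no t≮m | _ = ⊥-elim (t≮m t<m)

  Satisfies-mesAtLeast : ∀ r k t c → (t < m k → t ≡ a [mod A ] → r ≤ c) → Satisfies r (mesAtLeast k t) c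
  Satisfies-mesAtLeast r k t c required with t ℕ.<? m k | congruent? t a A
  ... | yes t<m | yes t≡a = required t<m t≡a
  ... | yes _ | no _ = tt
  ... | no _ | _ = tt

  Fits⇔IsMes : ∀ r k N n π → m k ≤ N → n ≤ N →
    Fits r (mesExactly k) (suc N) n π ⇔ (IsOverpartition π × weight π ≡ n × IsMes r A a π (m k))
  Fits⇔IsMes r k N n π m≤N n≤N = mk⇔ to from
    where
    1≤m : 1 ≤ m k
    1≤m = 1≤nthResidue A a k 1≤a
    to : Fits r (mesExactly k) (suc N) n π → IsOverpartition π × weight π ≡ n × IsMes r A a π (m k)
    to (overpartition , weight≡n , _ , satisfies) =
      overpartition , weight≡n , 1≤m , m-congruent k , fewer-at-m , enough-below
      where
      fewer-at-m : countSize (m k) π < r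
      fewer-at-m = subst (λ τ → Satisfies r τ (countSize (m k) π)) (mesExactly-at k)
                         (satisfies (m k) 1≤m (ℕP.m≤n⇒m≤1+n m≤N))
      enough-below : ∀ j → 1 ≤ j → j < m k → j ≡ a [mod A ] → r ≤ countSize j π
      enough-below j 1≤j j<m j≡a =
        subst (λ τ → Satisfies r τ (countSize j π))
              (trans (mesExactly-off k j (ℕP.<⇒≢ j<m)) (mesAtLeast-atLeast k j j<m j≡a))
              (satisfies j 1≤j (ℕP.m≤n⇒m≤1+n (ℕP.≤-trans (ℕP.<⇒≤ j<m) m≤N)))
    from : IsOverpartition π × weight π ≡ n × IsMes r A a π (m k) → Fits r (mesExactly k) (suc N) n π
    from (overpartition , weight≡n , _ , _ , fewer-at-m , enough-below) =
      overpartition , weight≡n , sizes≤D , satisfies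
      where
      sizes≤D : All (λ p → size p ≤ suc N) π
      sizes≤D = All.map (λ p≤w → ℕP.m≤n⇒m≤1+n (ℕP.≤-trans p≤w (subst (_≤ N) (sym weight≡n) n≤N))) (size-≤-weight π)
      satisfies : ∀ t → 1 ≤ t → t ≤ suc N → Satisfies r (mesExactly k t) (countSize t π)
      satisfies t 1≤t _ with t ℕ.≟ m k
      ... | yes refl = fewer-at-m
      ... | no _ = Satisfies-mesAtLeast r k t _ (enough-below t 1≤t)

  HasCard-mes : ∀ r .{{_ : ℕ.NonZero r}} t n →
    HasCard (λ π → IsOverpartition π × (weight π ≡ n) × IsMes r A a π t) (rhsCoeff r A a t n)
  HasCard-mes r t n with (1 ℕ.≤? t) ×-dec congruent? t a A
  ... | yes (1≤t , t≡a) with congruent⇒nthResidue t 1≤t t≡a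
  ...   | k , refl =
    fitting r (mesExactly k) (suc N) n , fitting-unique r (mesExactly k) (suc N) n ,
    (λ π → Fits⇔IsMes r k N n π m≤N n≤N ⇔-∘ ∈-fitting⇔Fits r (mesExactly k) (suc N) n π) ,
    (begin
      + length (fitting r (mesExactly k) (suc N) n)  ≡⟨ length-fitting r (mesExactly k) (suc N) n ⟩
      productGF r (mesExactly k) (suc N) n           ≡⟨ productGF-mesExactly r N k m≤N n n≤N ⟩
      (overPartGF ⊛ bracket r A a k) n               ≡⟨ ⊛-congˡ overPartGF (zCoeffSum-nthResidue r k) n ⟨
      rhsCoeff r A a (m k) n                         ∎)
    where
    open ≡-Reasoning
    N : ℕ
    N = n ℕ.+ m k
    m≤N : m k ≤ N
    m≤N = ℕP.m≤n+m (m k) n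
    n≤N : n ≤ N
    n≤N = ℕP.m≤m+n n (m k)
  HasCard-mes r t n | no ¬residue =
    [] , [] , (λ π → mk⇔ (λ ()) (λ (_ , _ , 1≤t , t≡a , _) → ⊥-elim (¬residue (1≤t , t≡a)))) ,
    sym (trans (⊛-congˡ overPartGF (zCoeffSum-non-residue r t λ k mk≡t → ¬residue (residue k mk≡t)) n)
               (⊛-zeroʳ overPartGF n))
    where
    residue : ∀ k → m k ≡ t → 1 ≤ t × t ≡ a [mod A ]
    residue k refl = 1≤nthResidue A a k 1≤a , m-congruent k

theorem2p1 : (A a r : ℕ) → 1 ≤ a → a ≤ A → 1 ≤ r →
    (m n : ℕ) →
    HasCard (λ π → IsOverpartition π × (weight π ≡ n) × IsMes r A a π m)
            (rhsCoeff r A a m n)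
theorem2p1 A a r 1≤a a≤A 1≤r = Progression.HasCard-mes A a 1≤a a≤A r {{ℕ.>-nonZero 1≤r}}
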